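{- For every element $g\in\mathrm{PSL}_q(2,\mathbb{Z})$ and every matrix $M\in\mathrm{GL}(2,\mathbb{Z}[q^{\pm1}])$ representing $g$, the trace of $M$ is of the form $\pm q^N\,T(q)$ with $N\in\mathbb{Z}$ and $T\in\mathbb{Z}[q]$ a palindromic polynomial with positive integer coefficients.
   Context: Let $\mathrm{U}=\{\pm q^N: N\in\mathbb{Z}\}$, $\mathrm{GL}(2,\mathbb{Z}[q^{\pm1}])$ the $2\times2$ matrices over $\mathbb{Z}[q^{\pm1}]$ with determinant in $\mathrm{U}$, and $\mathrm{PGL}(2,\mathbb{Z}[q^{\pm1}])=\mathrm{GL}(2,\mathbb{Z}[q^{\pm1}])/\{\pm q^N\mathrm{Id}\}$. With $R_q=\begin{pmatrix}q&1\\0&1\end{pmatrix}$, $S_q=\begin{pmatrix}0&-q^{ -1}\\1&0\end{pmatrix}$, $\mathrm{PSL}_q(2,\mathbb{Z})$ is the subgroup of $\mathrm{PGL}(2,\mathbb{Z}[q^{\pm1}])$ generated by the classes of $R_q$ and $S_q$. A polynomial $T$ is palindromic if its ordered sequence of coefficients reads the same backward and forward, i.e. $T(q)=q^{n}T(q^{ -1})$ for some $n\in\mathbb{Z}$. -}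

module Defs where

open import Data.Nat using (ℕ; zero; suc)
open import Data.Integer as ℤ using (ℤ; +_; -[1+_]; _◃_; _⊔_; _⊓_)
open import Data.Sign using (Sign)
open import Data.List using (List; []; _∷_; map; replicate; _++_)
open import Data.Product using (Σ; ∃; _×_; _,_)
open import Relation.Binary.PropositionalEquality using (_≡_)

-- Polynomials in ℤ[q] as coefficient lists (constant term first).

padd : List ℤ → List ℤ → List ℤ
padd []       bs       = bs
padd (a ∷ as) []       = a ∷ as
padd (a ∷ as) (b ∷ bs) = (a ℤ.+ b) ∷ padd as bs

pmul : List ℤ → List ℤ → List ℤ
pmul []       bs = []
pmul (a ∷ as) bs = padd (map (a ℤ.*_) bs) (+ 0 ∷ pmul as bs)

lcoeff : {A : Set} → A → List A → ℕ → A
lcoeff z []       _       = z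
lcoeff z (a ∷ as) zero    = a
lcoeff z (a ∷ as) (suc i) = lcoeff z as i

icoeff : {A : Set} → A → List A → ℤ → A
icoeff z as (+ n)    = lcoeff z as n
icoeff z as -[1+ n ] = z

-- Laurent polynomials ℤ[q, q⁻¹]:  mkL s cs  denotes  q^s · Σᵢ csᵢ qⁱ.

record Laurent : Set where
  constructor mkL
  field
    shift  : ℤ
    coeffs : List ℤ

coeff : Laurent → ℤ → ℤ
coeff (mkL s cs) k = icoeff (+ 0) cs (k ℤ.- s)

infix 4 _≈_
_≈_ : Laurent → Laurent → Set
a ≈ b = ∀ k → coeff a k ≡ coeff b k

private
  pad : ℤ → List ℤ → List ℤ
  pad d cs = replicate ℤ.∣ d ∣ (+ 0) ++ cs

infixl 6 _+L_
infixl 7 _*L_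

_+L_ : Laurent → Laurent → Laurent
mkL s as +L mkL t bs =
  mkL (s ⊓ t) (padd (pad (s ℤ.- (s ⊓ t)) as) (pad (t ℤ.- (s ⊓ t)) bs))

_*L_ : Laurent → Laurent → Laurent
mkL s as *L mkL t bs = mkL (s ℤ.+ t) (pmul as bs)

-L_ : Laurent → Laurent
-L mkL s as = mkL s (map ℤ.-_ as)

mono : ℤ → ℤ → Laurent
mono c N = mkL N (c ∷ [])

0L 1L : Laurent
0L = mono (+ 0) (+ 0)
1L = mono (+ 1) (+ 0)

unit : Sign → ℤ → Laurent
unit s N = mono (s ◃ 1) N

IsUnit : Laurent → Set
IsUnit x = Σ Sign λ s → Σ ℤ λ N → x ≈ unit s N

record Mat : Set where
  constructor mat
  field
    a b c d : Laurent

infixl 7 _·_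
_·_ : Mat → Mat → Mat
mat a b c d · mat a' b' c' d' =
  mat (a *L a' +L b *L c') (a *L b' +L b *L d')
      (c *L a' +L d *L c') (c *L b' +L d *L d')

infix 4 _≈M_
_≈M_ : Mat → Mat → Set
mat a b c d ≈M mat a' b' c' d' = (a ≈ a') × (b ≈ b') × (c ≈ c') × (d ≈ d')

scale : Laurent → Mat → Mat
scale x (mat a b c d) = mat (x *L a) (x *L b) (x *L c) (x *L d)

trace : Mat → Laurent
trace (mat a b c d) = a +L d

det : Mat → Laurent
det (mat a b c d) = a *L d +L (-L (b *L c))

Id : Mat
Id = mat 1L 0L 0L 1L

InGL : Mat → Set
InGL M = IsUnit (det M)

data Gen : Set where
  R R⁻¹ S S⁻¹ : Gen

genMat : Gen → Mat
genMat R   = mat (mono (+ 1) (+ 1)) 1L 0L 1L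
genMat R⁻¹ = mat (mono (+ 1) (ℤ.- (+ 1))) (mono (ℤ.- (+ 1)) (ℤ.- (+ 1))) 0L 1L
genMat S   = mat 0L (mono (ℤ.- (+ 1)) (ℤ.- (+ 1))) 1L 0L
genMat S⁻¹ = mat 0L 1L (mono (ℤ.- (+ 1)) (+ 1)) 0L

evalWord : List Gen → Mat
evalWord []      = Id
evalWord (x ∷ w) = genMat x · evalWord w

-- M ∈ GL(2) represents the class in PGL(2) of the matrix W,
-- i.e. M = u · W for some u ∈ U.
Represents : Mat → Mat → Set
Represents M W = InGL M × (Σ Sign λ s → Σ ℤ λ N → M ≈M scale (unit s N) W)

embed : List ℕ → Laurent
embed T = mkL (+ 0) (map +_ T)

-- T(q) = q^n T(q⁻¹) for some n ∈ ℤ, coefficientwise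
Palindromic : List ℕ → Set
Palindromic T = ∃ λ (n : ℤ) → ∀ (k : ℤ) → icoeff 0 T k ≡ icoeff 0 T (n ℤ.- k)

{-# OPTIONS --safe #-}
-- Identities in ℤ[q, q⁻¹] are checked after substituting q = 1, 2, 3, …, where they become identities
-- in ℚ: a Laurent polynomial vanishing at every positive integer is zero. With U = R_q S_q, both S_q²
-- and U³ are units ±q^N, and R_q = -q U S_q, so every word in the generators is a unit times a product
-- of blocks U^c S_q followed by U^t. The trace is invariant under rotation, so U^t merges into the first
-- block, and a block with c ≡ 0 (mod 3) cancels against its neighbour through S_q². What remains is, up
-- to a unit, the trace of S_q (zero), of U or U² (±1), or of a product of the blocks U S_q = -q⁻¹ R_q and
-- U² S_q = -q⁻¹ L_q with L_q = (q 0; q 1), whose entries lie in ℕ[q]. Finally C X(q) = q X(q⁻¹) C for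
-- X ∈ {R_q, L_q} and C = (q, 1-q; q-1, 1), an invertible matrix when q ∈ ℕ⁺, so the trace T of a product
-- of k letters satisfies T(q) = q^k T(q⁻¹): T is palindromic.

module Submission where

open import Defs
open import Data.Integer using (ℤ)
open import Data.Nat using (ℕ)
open import Data.Sign as Sign using (Sign)
open import Data.List using (List)
open import Data.Product using (Σ; _×_)

open import Level using (0ℓ)
open import Algebra.Bundles using (CommutativeRing)
open import Data.Empty using (⊥-elim)
open import Data.Maybe.Base using (Maybe; just; nothing)
open import Data.Sum using (_⊎_; inj₁; inj₂)
open import Data.Product using (_,_; ∃)
open import Data.Nat as ℕ using (zero; suc)
import Data.Nat.Properties as ℕP
open import Data.Integer as ℤ using (+_; -[1+_]; _⊖_; ∣_∣)
import Data.Integer.Properties as ℤP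
open import Data.Integer.Tactic.RingSolver using () renaming (solve-∀ to ℤ-solve)
open import Data.Rational as ℚ using (ℚ; 0ℚ; 1ℚ; _+_; _*_; -_; _-_; 1/_)
import Data.Rational.Properties as ℚP
open import Data.Rational.Literals using (fromℤ)
open import Data.Rational.Unnormalised as ℚᵘ using (mkℚᵘ; *≡*)
import Data.Rational.Unnormalised.Properties as ℚᵘP
open import Algebra.Properties.CommutativeSemiring.Exp (CommutativeRing.commutativeSemiring ℚP.+-*-commutativeRing) using (_^_; ^-homo-*)
open import Algebra.Properties.CommutativeSemigroup (CommutativeRing.*-commutativeSemigroup ℚP.+-*-commutativeRing) using () renaming (interchange to *-interchange)
open import Data.List using ([]; _∷_; map; replicate; _++_; length; _∷ʳ_; initLast; _∷ʳ′_; reverse)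
import Data.List.Properties as LP
open import Relation.Binary.PropositionalEquality
open import Relation.Nullary using (yes; no)
open import Tactic.RingSolver using (solve-∀)
open import Tactic.RingSolver.Core.AlmostCommutativeRing using (AlmostCommutativeRing; fromCommutativeRing)

ℚ-ring : AlmostCommutativeRing 0ℓ 0ℓ
ℚ-ring = fromCommutativeRing ℚP.+-*-commutativeRing isZero
  where
  isZero : (x : ℚ) → Maybe (0ℚ ≡ x)
  isZero x with x ℚP.≟ 0ℚ
  ... | yes x≡0 = just (sym x≡0)
  ... | no _    = nothing

module _ where
  open ℚᵘP.≃-Reasoning

  fromℤ-+ : ∀ a b → fromℤ (a ℤ.+ b) ≡ fromℤ a + fromℤ b
  fromℤ-+ a b = ℚP.toℚᵘ-injective (begin
    mkℚᵘ (a ℤ.+ b) 0         ≈⟨ *≡* (cross-multiplied a b) ⟩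
    mkℚᵘ a 0 ℚᵘ.+ mkℚᵘ b 0   ≈⟨ ℚᵘP.≃-sym (ℚP.toℚᵘ-homo-+ (fromℤ a) (fromℤ b)) ⟩
    ℚ.toℚᵘ (fromℤ a + fromℤ b) ∎)
    where
    cross-multiplied : ∀ a b → (a ℤ.+ b) ℤ.* + 1 ≡ (a ℤ.* + 1 ℤ.+ b ℤ.* + 1) ℤ.* + 1
    cross-multiplied = ℤ-solve

  fromℤ-* : ∀ a b → fromℤ (a ℤ.* b) ≡ fromℤ a * fromℤ b
  fromℤ-* a b = ℚP.toℚᵘ-injective (begin
    mkℚᵘ (a ℤ.* b) 0         ≈⟨ *≡* refl ⟩
    mkℚᵘ a 0 ℚᵘ.* mkℚᵘ b 0   ≈⟨ ℚᵘP.≃-sym (ℚP.toℚᵘ-homo-* (fromℤ a) (fromℤ b)) ⟩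
    ℚ.toℚᵘ (fromℤ a * fromℤ b) ∎)

  fromℤ-neg : ∀ a → fromℤ (ℤ.- a) ≡ - fromℤ a
  fromℤ-neg a = ℚP.toℚᵘ-injective (ℚᵘP.≃-sym (ℚP.toℚᵘ-homo‿- (fromℤ a)))

fromℤ-injective : ∀ {a b} → fromℤ a ≡ fromℤ b → a ≡ b
fromℤ-injective {a} {b} eq with ℚP.toℚᵘ-cong eq
... | *≡* a*1≡b*1 = begin
  a          ≡⟨ ℤP.*-identityʳ a ⟨
  a ℤ.* + 1  ≡⟨ a*1≡b*1 ⟩
  b ℤ.* + 1  ≡⟨ ℤP.*-identityʳ b ⟩
  b          ∎
  where open ≡-Reasoning

*-cancelˡ-invertible : ∀ a a⁻¹ {x y} → a⁻¹ * a ≡ 1ℚ → a * x ≡ a * y → x ≡ y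
*-cancelˡ-invertible a a⁻¹ {x} {y} a⁻¹a≡1 ax≡ay = begin
  x                ≡⟨ ℚP.*-identityˡ x ⟨
  1ℚ * x           ≡⟨ cong (_* x) a⁻¹a≡1 ⟨
  (a⁻¹ * a) * x    ≡⟨ ℚP.*-assoc a⁻¹ a x ⟩
  a⁻¹ * (a * x)    ≡⟨ cong (a⁻¹ *_) ax≡ay ⟩
  a⁻¹ * (a * y)    ≡⟨ ℚP.*-assoc a⁻¹ a y ⟨
  (a⁻¹ * a) * y    ≡⟨ cong (_* y) a⁻¹a≡1 ⟩
  1ℚ * y           ≡⟨ ℚP.*-identityˡ y ⟩
  y                ∎
  where open ≡-Reasoning

-- Evaluation at invertible rational points

record Point : Set where
  field
    q q⁻¹   : ℚ
    q*q⁻¹≡1 : q * q⁻¹ ≡ 1ℚ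

open Point

invert : Point → Point
invert p = record { q = q⁻¹ p ; q⁻¹ = q p ; q*q⁻¹≡1 = trans (ℚP.*-comm (q⁻¹ p) (q p)) (q*q⁻¹≡1 p) }

infixr 8 _^ᶻ_
_^ᶻ_ : Point → ℤ → ℚ
p ^ᶻ + n      = q p ^ n
p ^ᶻ -[1+ n ] = q⁻¹ p ^ suc n

^ᶻ-⊖ : ∀ p m n → p ^ᶻ (m ⊖ n) ≡ q p ^ m * q⁻¹ p ^ n
^ᶻ-⊖ p m       zero    = sym (ℚP.*-identityʳ _)
^ᶻ-⊖ p zero    (suc n) = sym (ℚP.*-identityˡ _)
^ᶻ-⊖ p (suc m) (suc n) = begin
  p ^ᶻ (suc m ⊖ suc n)                    ≡⟨ cong (p ^ᶻ_) (ℤP.[1+m]⊖[1+n]≡m⊖n m n) ⟩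
  p ^ᶻ (m ⊖ n)                            ≡⟨ ^ᶻ-⊖ p m n ⟩
  x * y                                   ≡⟨ ℚP.*-identityˡ (x * y) ⟨
  1ℚ * (x * y)                            ≡⟨ cong (λ c → c * (x * y)) (q*q⁻¹≡1 p) ⟨
  (q p * q⁻¹ p) * (x * y)                 ≡⟨ *-interchange (q p) (q⁻¹ p) x y ⟩
  (q p * x) * (q⁻¹ p * y)                 ∎
  where
  open ≡-Reasoning
  x = q p ^ m
  y = q⁻¹ p ^ n

⊖-surjective : ∀ i → ∃ λ m → ∃ λ n → i ≡ m ⊖ n
⊖-surjective (+ m)      = m , 0 , refl
⊖-surjective -[1+ n ]   = 0 , suc n , refl

⊖-+-⊖ : ∀ m n m′ n′ → (m ⊖ n) ℤ.+ (m′ ⊖ n′) ≡ (m ℕ.+ m′) ⊖ (n ℕ.+ n′)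
⊖-+-⊖ m n m′ n′ = begin
  (m ⊖ n) ℤ.+ (m′ ⊖ n′)               ≡⟨ cong₂ ℤ._+_ (ℤP.[+m]-[+n]≡m⊖n m n) (ℤP.[+m]-[+n]≡m⊖n m′ n′) ⟨
  (+ m ℤ.- + n) ℤ.+ (+ m′ ℤ.- + n′)   ≡⟨ regroup (+ m) (+ n) (+ m′) (+ n′) ⟩
  (+ m ℤ.+ + m′) ℤ.- (+ n ℤ.+ + n′)   ≡⟨ ℤP.[+m]-[+n]≡m⊖n (m ℕ.+ m′) (n ℕ.+ n′) ⟩
  (m ℕ.+ m′) ⊖ (n ℕ.+ n′)             ∎
  where
  open ≡-Reasoning
  regroup : ∀ a b c d → (a ℤ.- b) ℤ.+ (c ℤ.- d) ≡ (a ℤ.+ c) ℤ.- (b ℤ.+ d)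
  regroup = ℤ-solve

^ᶻ-+ : ∀ p i j → p ^ᶻ (i ℤ.+ j) ≡ p ^ᶻ i * p ^ᶻ j
^ᶻ-+ p i j with ⊖-surjective i | ⊖-surjective j
... | m , n , refl | m′ , n′ , refl = begin
  p ^ᶻ ((m ⊖ n) ℤ.+ (m′ ⊖ n′))                   ≡⟨ cong (p ^ᶻ_) (⊖-+-⊖ m n m′ n′) ⟩
  p ^ᶻ ((m ℕ.+ m′) ⊖ (n ℕ.+ n′))                 ≡⟨ ^ᶻ-⊖ p (m ℕ.+ m′) (n ℕ.+ n′) ⟩
  q p ^ (m ℕ.+ m′) * q⁻¹ p ^ (n ℕ.+ n′)          ≡⟨ cong₂ _*_ (^-homo-* (q p) m m′) (^-homo-* (q⁻¹ p) n n′) ⟩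
  (q p ^ m * q p ^ m′) * (q⁻¹ p ^ n * q⁻¹ p ^ n′) ≡⟨ *-interchange (q p ^ m) (q p ^ m′) (q⁻¹ p ^ n) (q⁻¹ p ^ n′) ⟩
  (q p ^ m * q⁻¹ p ^ n) * (q p ^ m′ * q⁻¹ p ^ n′) ≡⟨ cong₂ _*_ (^ᶻ-⊖ p m n) (^ᶻ-⊖ p m′ n′) ⟨
  p ^ᶻ (m ⊖ n) * p ^ᶻ (m′ ⊖ n′)                  ∎
  where
  open ≡-Reasoning

^ᶻ-inverseˡ : ∀ p i → p ^ᶻ (ℤ.- i) * p ^ᶻ i ≡ 1ℚ
^ᶻ-inverseˡ p i = trans (sym (^ᶻ-+ p (ℤ.- i) i)) (cong (p ^ᶻ_) (ℤP.+-inverseˡ i))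

^ᶻ-cancelˡ : ∀ p i {x y} → p ^ᶻ i * x ≡ p ^ᶻ i * y → x ≡ y
^ᶻ-cancelˡ p i = *-cancelˡ-invertible (p ^ᶻ i) (p ^ᶻ (ℤ.- i)) (^ᶻ-inverseˡ p i)

evalPoly : ℚ → List ℤ → ℚ
evalPoly x []       = 0ℚ
evalPoly x (c ∷ cs) = fromℤ c + x * evalPoly x cs

module _ (x : ℚ) where
  open ≡-Reasoning

  evalPoly-padd : ∀ as bs → evalPoly x (padd as bs) ≡ evalPoly x as + evalPoly x bs
  evalPoly-padd []       bs       = sym (ℚP.+-identityˡ _)
  evalPoly-padd (a ∷ as) []       = sym (ℚP.+-identityʳ _)
  evalPoly-padd (a ∷ as) (b ∷ bs) = begin
    fromℤ (a ℤ.+ b) + x * evalPoly x (padd as bs)           ≡⟨ cong₂ (λ u v → u + x * v) (fromℤ-+ a b) (evalPoly-padd as bs) ⟩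
    (fromℤ a + fromℤ b) + x * (evalPoly x as + evalPoly x bs) ≡⟨ regroup (fromℤ a) (fromℤ b) x (evalPoly x as) (evalPoly x bs) ⟩
    (fromℤ a + x * evalPoly x as) + (fromℤ b + x * evalPoly x bs) ∎
    where
    regroup : ∀ a b x u v → (a + b) + x * (u + v) ≡ (a + x * u) + (b + x * v)
    regroup = solve-∀ ℚ-ring

  evalPoly-scale : ∀ a bs → evalPoly x (map (a ℤ.*_) bs) ≡ fromℤ a * evalPoly x bs
  evalPoly-scale a []       = sym (ℚP.*-zeroʳ (fromℤ a))
  evalPoly-scale a (b ∷ bs) = begin
    fromℤ (a ℤ.* b) + x * evalPoly x (map (a ℤ.*_) bs) ≡⟨ cong₂ (λ u v → u + x * v) (fromℤ-* a b) (evalPoly-scale a bs) ⟩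
    fromℤ a * fromℤ b + x * (fromℤ a * evalPoly x bs)   ≡⟨ regroup (fromℤ a) (fromℤ b) x (evalPoly x bs) ⟩
    fromℤ a * (fromℤ b + x * evalPoly x bs)             ∎
    where
    regroup : ∀ a b x u → a * b + x * (a * u) ≡ a * (b + x * u)
    regroup = solve-∀ ℚ-ring

  evalPoly-pmul : ∀ as bs → evalPoly x (pmul as bs) ≡ evalPoly x as * evalPoly x bs
  evalPoly-pmul []       bs = sym (ℚP.*-zeroˡ (evalPoly x bs))
  evalPoly-pmul (a ∷ as) bs = begin
    evalPoly x (padd (map (a ℤ.*_) bs) (+ 0 ∷ pmul as bs))
      ≡⟨ evalPoly-padd (map (a ℤ.*_) bs) (+ 0 ∷ pmul as bs) ⟩
    evalPoly x (map (a ℤ.*_) bs) + (0ℚ + x * evalPoly x (pmul as bs))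
      ≡⟨ cong₂ (λ u v → u + (0ℚ + x * v)) (evalPoly-scale a bs) (evalPoly-pmul as bs) ⟩
    fromℤ a * evalPoly x bs + (0ℚ + x * (evalPoly x as * evalPoly x bs))
      ≡⟨ regroup (fromℤ a) (evalPoly x bs) x (evalPoly x as) ⟩
    (fromℤ a + x * evalPoly x as) * evalPoly x bs ∎
    where
    regroup : ∀ a b x u → a * b + (0ℚ + x * (u * b)) ≡ (a + x * u) * b
    regroup = solve-∀ ℚ-ring

  evalPoly-neg : ∀ as → evalPoly x (map ℤ.-_ as) ≡ - evalPoly x as
  evalPoly-neg []       = refl
  evalPoly-neg (a ∷ as) = begin
    fromℤ (ℤ.- a) + x * evalPoly x (map ℤ.-_ as) ≡⟨ cong₂ (λ u v → u + x * v) (fromℤ-neg a) (evalPoly-neg as) ⟩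
    - fromℤ a + x * (- evalPoly x as)             ≡⟨ regroup (fromℤ a) x (evalPoly x as) ⟩
    - (fromℤ a + x * evalPoly x as)               ∎
    where
    regroup : ∀ a x u → - a + x * (- u) ≡ - (a + x * u)
    regroup = solve-∀ ℚ-ring

  evalPoly-++ : ∀ as bs → evalPoly x (as ++ bs) ≡ evalPoly x as + x ^ length as * evalPoly x bs
  evalPoly-++ []       bs = sym (trans (ℚP.+-identityˡ _) (ℚP.*-identityˡ _))
  evalPoly-++ (a ∷ as) bs = begin
    fromℤ a + x * evalPoly x (as ++ bs)                               ≡⟨ cong (λ v → fromℤ a + x * v) (evalPoly-++ as bs) ⟩
    fromℤ a + x * (evalPoly x as + x ^ length as * evalPoly x bs)     ≡⟨ regroup (fromℤ a) x (evalPoly x as) (x ^ length as) (evalPoly x bs) ⟩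
    (fromℤ a + x * evalPoly x as) + x * x ^ length as * evalPoly x bs ∎
    where
    regroup : ∀ a x u v w → a + x * (u + v * w) ≡ (a + x * u) + x * v * w
    regroup = solve-∀ ℚ-ring

  evalPoly-pad : ∀ n cs → evalPoly x (replicate n (+ 0) ++ cs) ≡ x ^ n * evalPoly x cs
  evalPoly-pad zero    cs = sym (ℚP.*-identityˡ _)
  evalPoly-pad (suc n) cs = begin
    0ℚ + x * evalPoly x (replicate n (+ 0) ++ cs) ≡⟨ cong (λ v → 0ℚ + x * v) (evalPoly-pad n cs) ⟩
    0ℚ + x * (x ^ n * evalPoly x cs)              ≡⟨ regroup x (x ^ n) (evalPoly x cs) ⟩
    x * x ^ n * evalPoly x cs                     ∎
    where
    regroup : ∀ x u v → 0ℚ + x * (u * v) ≡ x * u * v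
    regroup = solve-∀ ℚ-ring

evalL : Point → Laurent → ℚ
evalL p (mkL s cs) = p ^ᶻ s * evalPoly (q p) cs

evalL-lowerShift : ∀ p {m s} cs → m ℤ.≤ s →
  evalL p (mkL s cs) ≡ evalL p (mkL m (replicate ∣ s ℤ.- m ∣ (+ 0) ++ cs))
evalL-lowerShift p {m} {s} cs m≤s = begin
  p ^ᶻ s * evalPoly (q p) cs                              ≡⟨ cong (λ i → p ^ᶻ i * evalPoly (q p) cs) m+[s-m]≡s ⟨
  p ^ᶻ (m ℤ.+ + ∣ s ℤ.- m ∣) * evalPoly (q p) cs          ≡⟨ cong (_* evalPoly (q p) cs) (^ᶻ-+ p m _) ⟩
  (p ^ᶻ m * q p ^ ∣ s ℤ.- m ∣) * evalPoly (q p) cs        ≡⟨ ℚP.*-assoc (p ^ᶻ m) _ _ ⟩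
  p ^ᶻ m * (q p ^ ∣ s ℤ.- m ∣ * evalPoly (q p) cs)        ≡⟨ cong (p ^ᶻ m *_) (evalPoly-pad (q p) ∣ s ℤ.- m ∣ cs) ⟨
  p ^ᶻ m * evalPoly (q p) (replicate ∣ s ℤ.- m ∣ (+ 0) ++ cs) ∎
  where
  open ≡-Reasoning
  m+[s-m]≡s : m ℤ.+ + ∣ s ℤ.- m ∣ ≡ s
  m+[s-m]≡s = trans (cong (λ i → m ℤ.+ i) (ℤP.0≤i⇒+∣i∣≡i (ℤP.i≤j⇒0≤j-i m≤s))) (cancel m s)
    where
    cancel : ∀ m s → m ℤ.+ (s ℤ.- m) ≡ s
    cancel = ℤ-solve

evalL-+L : ∀ p x y → evalL p (x +L y) ≡ evalL p x + evalL p y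
evalL-+L p (mkL s as) (mkL t bs) = begin
  p ^ᶻ m * evalPoly (q p) (padd as′ bs′)                           ≡⟨ cong (p ^ᶻ m *_) (evalPoly-padd (q p) as′ bs′) ⟩
  p ^ᶻ m * (evalPoly (q p) as′ + evalPoly (q p) bs′)              ≡⟨ ℚP.*-distribˡ-+ (p ^ᶻ m) _ _ ⟩
  p ^ᶻ m * evalPoly (q p) as′ + p ^ᶻ m * evalPoly (q p) bs′       ≡⟨ cong₂ _+_ (evalL-lowerShift p as (ℤP.i⊓j≤i s t))
                                                                                (evalL-lowerShift p bs (ℤP.i⊓j≤j s t)) ⟨
  p ^ᶻ s * evalPoly (q p) as + p ^ᶻ t * evalPoly (q p) bs         ∎
  where
  open ≡-Reasoning
  m = s ℤ.⊓ t
  as′ = replicate ∣ s ℤ.- m ∣ (+ 0) ++ as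
  bs′ = replicate ∣ t ℤ.- m ∣ (+ 0) ++ bs

evalL-*L : ∀ p x y → evalL p (x *L y) ≡ evalL p x * evalL p y
evalL-*L p (mkL s as) (mkL t bs) = begin
  p ^ᶻ (s ℤ.+ t) * evalPoly (q p) (pmul as bs)                     ≡⟨ cong₂ _*_ (^ᶻ-+ p s t) (evalPoly-pmul (q p) as bs) ⟩
  (p ^ᶻ s * p ^ᶻ t) * (evalPoly (q p) as * evalPoly (q p) bs)      ≡⟨ *-interchange (p ^ᶻ s) (p ^ᶻ t) _ _ ⟩
  (p ^ᶻ s * evalPoly (q p) as) * (p ^ᶻ t * evalPoly (q p) bs)      ∎
  where
  open ≡-Reasoning

evalL-mono : ∀ p c N → evalL p (mono c N) ≡ p ^ᶻ N * fromℤ c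
evalL-mono p c N = cong (p ^ᶻ N *_) (simplify (fromℤ c) (q p))
  where
  simplify : ∀ c x → c + x * 0ℚ ≡ c
  simplify = solve-∀ ℚ-ring

-- A Laurent polynomial is determined by its values at q = 1, 2, 3, …

natPoint : ℕ → Point
natPoint n = record { q = fromℤ (+ suc n) ; q⁻¹ = 1/ fromℤ (+ suc n) ; q*q⁻¹≡1 = ℚP.*-inverseʳ (fromℤ (+ suc n)) }

evalPolyℤ : ℤ → List ℤ → ℤ
evalPolyℤ x []       = + 0
evalPolyℤ x (c ∷ cs) = c ℤ.+ x ℤ.* evalPolyℤ x cs

evalPoly-fromℤ : ∀ x cs → evalPoly (fromℤ x) cs ≡ fromℤ (evalPolyℤ x cs)
evalPoly-fromℤ x []       = refl
evalPoly-fromℤ x (c ∷ cs) = begin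
  fromℤ c + fromℤ x * evalPoly (fromℤ x) cs      ≡⟨ cong (λ v → fromℤ c + fromℤ x * v) (evalPoly-fromℤ x cs) ⟩
  fromℤ c + fromℤ x * fromℤ (evalPolyℤ x cs)     ≡⟨ cong (λ v → fromℤ c + v) (fromℤ-* x (evalPolyℤ x cs)) ⟨
  fromℤ c + fromℤ (x ℤ.* evalPolyℤ x cs)         ≡⟨ fromℤ-+ c (x ℤ.* evalPolyℤ x cs) ⟨
  fromℤ (c ℤ.+ x ℤ.* evalPolyℤ x cs)             ∎
  where open ≡-Reasoning

a+b≡0⇒a≡-b : ∀ a b → a ℤ.+ b ≡ + 0 → a ≡ ℤ.- b
a+b≡0⇒a≡-b a b a+b≡0 = trans (subtract a b) (trans (cong (ℤ._- b) a+b≡0) (ℤP.+-identityˡ (ℤ.- b)))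
  where
  subtract : ∀ a b → a ≡ (a ℤ.+ b) ℤ.- b
  subtract = ℤ-solve

-- For a ∷ cs = a + q·e(q) we get a = -(n+1)·e(n+1) for all n; at n = ∣a∣ this forces e(∣a∣+1) = 0 by size,
-- so a = 0, and then e vanishes at every positive integer as well.
vanishing⇒coeff≡0 : ∀ cs → (∀ n → evalPolyℤ (+ suc n) cs ≡ + 0) → ∀ i → lcoeff (+ 0) cs i ≡ + 0
vanishing⇒coeff≡0 []       _      i       = refl
vanishing⇒coeff≡0 (a ∷ cs) vanish = coeff≡0
  where
  e : ℕ → ℤ
  e n = evalPolyℤ (+ suc n) cs
  ∣a∣≡[1+∣a∣]∣e∣ : ∣ a ∣ ≡ suc ∣ a ∣ ℕ.* ∣ e ∣ a ∣ ∣
  ∣a∣≡[1+∣a∣]∣e∣ = begin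
    ∣ a ∣                                ≡⟨ cong ∣_∣ (a+b≡0⇒a≡-b a _ (vanish ∣ a ∣)) ⟩
    ∣ ℤ.- (+ suc ∣ a ∣ ℤ.* e ∣ a ∣) ∣     ≡⟨ ℤP.∣-i∣≡∣i∣ (+ suc ∣ a ∣ ℤ.* e ∣ a ∣) ⟩
    ∣ + suc ∣ a ∣ ℤ.* e ∣ a ∣ ∣           ≡⟨ ℤP.abs-* (+ suc ∣ a ∣) (e ∣ a ∣) ⟩
    suc ∣ a ∣ ℕ.* ∣ e ∣ a ∣ ∣             ∎
    where open ≡-Reasoning
  ∣e∣≡0 : ∣ e ∣ a ∣ ∣ ≡ 0
  ∣e∣≡0 with ∣ e ∣ a ∣ ∣ | ∣a∣≡[1+∣a∣]∣e∣
  ... | zero  | _  = refl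
  ... | suc k | eq = ⊥-elim (ℕP.<-irrefl eq (ℕP.m≤m*n (suc ∣ a ∣) (suc k)))
  a≡0 : a ≡ + 0
  a≡0 = begin
    a                                    ≡⟨ a+b≡0⇒a≡-b a _ (vanish ∣ a ∣) ⟩
    ℤ.- (+ suc ∣ a ∣ ℤ.* e ∣ a ∣)         ≡⟨ cong (λ v → ℤ.- (+ suc ∣ a ∣ ℤ.* v)) (ℤP.∣i∣≡0⇒i≡0 ∣e∣≡0) ⟩
    ℤ.- (+ suc ∣ a ∣ ℤ.* + 0)             ≡⟨ cong ℤ.-_ (ℤP.*-zeroʳ (+ suc ∣ a ∣)) ⟩
    + 0                                  ∎
    where open ≡-Reasoning
  [1+n]e≡0 : ∀ n → + suc n ℤ.* e n ≡ + 0
  [1+n]e≡0 n = begin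
    + suc n ℤ.* e n           ≡⟨ ℤP.+-identityˡ _ ⟨
    + 0 ℤ.+ + suc n ℤ.* e n   ≡⟨ cong (ℤ._+ (+ suc n ℤ.* e n)) a≡0 ⟨
    a ℤ.+ + suc n ℤ.* e n     ≡⟨ vanish n ⟩
    + 0                       ∎
    where open ≡-Reasoning
  e-vanishes : ∀ n → e n ≡ + 0
  e-vanishes n with ℤP.i*j≡0⇒i≡0∨j≡0 (+ suc n) ([1+n]e≡0 n)
  ... | inj₂ en≡0 = en≡0
  coeff≡0 : ∀ i → lcoeff (+ 0) (a ∷ cs) i ≡ + 0
  coeff≡0 zero    = a≡0
  coeff≡0 (suc i) = vanishing⇒coeff≡0 cs e-vanishes i

lcoeff-padd : ∀ as bs i → lcoeff (+ 0) (padd as bs) i ≡ lcoeff (+ 0) as i ℤ.+ lcoeff (+ 0) bs i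
lcoeff-padd []       bs       i       = sym (ℤP.+-identityˡ _)
lcoeff-padd (a ∷ as) []       zero    = sym (ℤP.+-identityʳ a)
lcoeff-padd (a ∷ as) []       (suc i) = sym (ℤP.+-identityʳ _)
lcoeff-padd (a ∷ as) (b ∷ bs) zero    = refl
lcoeff-padd (a ∷ as) (b ∷ bs) (suc i) = lcoeff-padd as bs i

lcoeff-scale : ∀ c as i → lcoeff (+ 0) (map (c ℤ.*_) as) i ≡ c ℤ.* lcoeff (+ 0) as i
lcoeff-scale c []       i       = sym (ℤP.*-zeroʳ c)
lcoeff-scale c (a ∷ as) zero    = refl
lcoeff-scale c (a ∷ as) (suc i) = lcoeff-scale c as i

lcoeff-neg : ∀ as i → lcoeff (+ 0) (map ℤ.-_ as) i ≡ ℤ.- lcoeff (+ 0) as i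
lcoeff-neg []       i       = refl
lcoeff-neg (a ∷ as) zero    = refl
lcoeff-neg (a ∷ as) (suc i) = lcoeff-neg as i

icoeff-padd : ∀ as bs k → icoeff (+ 0) (padd as bs) k ≡ icoeff (+ 0) as k ℤ.+ icoeff (+ 0) bs k
icoeff-padd as bs (+ i)    = lcoeff-padd as bs i
icoeff-padd as bs -[1+ i ] = refl

icoeff-pad : ∀ n cs k → icoeff (+ 0) (replicate n (+ 0) ++ cs) k ≡ icoeff (+ 0) cs (k ℤ.- + n)
icoeff-pad zero    cs k          = cong (icoeff (+ 0) cs) (sym (ℤP.+-identityʳ k))
icoeff-pad (suc n) cs (+ zero)   = refl
icoeff-pad (suc n) cs -[1+ i ]   = refl
icoeff-pad (suc n) cs (+ suc i)  = trans (icoeff-pad n cs (+ i)) (cong (icoeff (+ 0) cs) (sym [1+i]-[1+n]≡i-n))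
  where
  [1+i]-[1+n]≡i-n : + suc i ℤ.- + suc n ≡ + i ℤ.- + n
  [1+i]-[1+n]≡i-n = begin
    + suc i ℤ.- + suc n   ≡⟨ ℤP.[+m]-[+n]≡m⊖n (suc i) (suc n) ⟩
    suc i ⊖ suc n         ≡⟨ ℤP.[1+m]⊖[1+n]≡m⊖n i n ⟩
    i ⊖ n                 ≡⟨ ℤP.[+m]-[+n]≡m⊖n i n ⟨
    + i ℤ.- + n           ∎
    where open ≡-Reasoning

coeff-lowerShift : ∀ {m s} cs → m ℤ.≤ s → ∀ k →
  coeff (mkL m (replicate ∣ s ℤ.- m ∣ (+ 0) ++ cs)) k ≡ coeff (mkL s cs) k
coeff-lowerShift {m} {s} cs m≤s k =
  trans (icoeff-pad ∣ s ℤ.- m ∣ cs (k ℤ.- m)) (cong (icoeff (+ 0) cs) k-m-[s-m]≡k-s)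
  where
  k-m-[s-m]≡k-s : k ℤ.- m ℤ.- + ∣ s ℤ.- m ∣ ≡ k ℤ.- s
  k-m-[s-m]≡k-s = trans (cong (λ d → k ℤ.- m ℤ.- d) (ℤP.0≤i⇒+∣i∣≡i (ℤP.i≤j⇒0≤j-i m≤s))) (cancel k m s)
    where
    cancel : ∀ k m s → k ℤ.- m ℤ.- (s ℤ.- m) ≡ k ℤ.- s
    cancel = ℤ-solve

coeff-+L : ∀ x y k → coeff (x +L y) k ≡ coeff x k ℤ.+ coeff y k
coeff-+L (mkL s as) (mkL t bs) k = trans (icoeff-padd as′ bs′ (k ℤ.- m))
  (cong₂ ℤ._+_ (coeff-lowerShift as (ℤP.i⊓j≤i s t) k) (coeff-lowerShift bs (ℤP.i⊓j≤j s t) k))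
  where
  m = s ℤ.⊓ t
  as′ = replicate ∣ s ℤ.- m ∣ (+ 0) ++ as
  bs′ = replicate ∣ t ℤ.- m ∣ (+ 0) ++ bs

coeff-mono-*L : ∀ c N x k → coeff (mono c N *L x) k ≡ c ℤ.* coeff x (k ℤ.- N)
coeff-mono-*L c N (mkL t cs) k = trans (icoeff-c·cs (k ℤ.- (N ℤ.+ t))) (cong (λ i → c ℤ.* icoeff (+ 0) cs i) (reassoc k N t))
  where
  reassoc : ∀ k N t → k ℤ.- (N ℤ.+ t) ≡ k ℤ.- N ℤ.- t
  reassoc = ℤ-solve
  icoeff-c·cs : ∀ i → icoeff (+ 0) (padd (map (c ℤ.*_) cs) (+ 0 ∷ [])) i ≡ c ℤ.* icoeff (+ 0) cs i
  icoeff-c·cs -[1+ i ]  = sym (ℤP.*-zeroʳ c)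
  icoeff-c·cs (+ zero)  = trans (lcoeff-padd (map (c ℤ.*_) cs) (+ 0 ∷ []) zero) (trans (ℤP.+-identityʳ _) (lcoeff-scale c cs zero))
  icoeff-c·cs (+ suc i) = trans (lcoeff-padd (map (c ℤ.*_) cs) (+ 0 ∷ []) (suc i)) (trans (ℤP.+-identityʳ _) (lcoeff-scale c cs (suc i)))

≈-trans : ∀ {x y z} → x ≈ y → y ≈ z → x ≈ z
≈-trans x≈y y≈z k = trans (x≈y k) (y≈z k)

mono-*L-cong : ∀ c N {x y} → x ≈ y → mono c N *L x ≈ mono c N *L y
mono-*L-cong c N {x} {y} x≈y k =
  trans (coeff-mono-*L c N x k) (trans (cong (c ℤ.*_) (x≈y (k ℤ.- N))) (sym (coeff-mono-*L c N y k)))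

unit-*L-unit : ∀ s N t M x → unit s N *L (unit t M *L x) ≈ unit (s Sign.* t) (N ℤ.+ M) *L x
unit-*L-unit s N t M x k = begin
  coeff (unit s N *L (unit t M *L x)) k                   ≡⟨ coeff-mono-*L (s ℤ.◃ 1) N _ k ⟩
  (s ℤ.◃ 1) ℤ.* coeff (unit t M *L x) (k ℤ.- N)           ≡⟨ cong ((s ℤ.◃ 1) ℤ.*_) (coeff-mono-*L (t ℤ.◃ 1) M x (k ℤ.- N)) ⟩
  (s ℤ.◃ 1) ℤ.* ((t ℤ.◃ 1) ℤ.* coeff x (k ℤ.- N ℤ.- M))   ≡⟨ ℤP.*-assoc (s ℤ.◃ 1) (t ℤ.◃ 1) _ ⟨
  (s ℤ.◃ 1) ℤ.* (t ℤ.◃ 1) ℤ.* coeff x (k ℤ.- N ℤ.- M)     ≡⟨ cong₂ ℤ._*_ (◃1-* s t) (cong (coeff x) (reassoc k N M)) ⟩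
  ((s Sign.* t) ℤ.◃ 1) ℤ.* coeff x (k ℤ.- (N ℤ.+ M))      ≡⟨ coeff-mono-*L ((s Sign.* t) ℤ.◃ 1) (N ℤ.+ M) x k ⟨
  coeff (unit (s Sign.* t) (N ℤ.+ M) *L x) k              ∎
  where
  open ≡-Reasoning
  reassoc : ∀ k N M → k ℤ.- N ℤ.- M ≡ k ℤ.- (N ℤ.+ M)
  reassoc = ℤ-solve
  ◃1-* : ∀ s t → (s ℤ.◃ 1) ℤ.* (t ℤ.◃ 1) ≡ (s Sign.* t) ℤ.◃ 1
  ◃1-* Sign.+ Sign.+ = refl
  ◃1-* Sign.+ Sign.- = refl
  ◃1-* Sign.- Sign.+ = refl
  ◃1-* Sign.- Sign.- = refl

trace-scale : ∀ c N {M} W → M ≈M scale (mono c N) W → trace M ≈ mono c N *L trace W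
trace-scale c N {mat a _ _ d} (mat a′ _ _ d′) (a≈ , _ , _ , d≈) k = begin
  coeff (a +L d) k                                          ≡⟨ coeff-+L a d k ⟩
  coeff a k ℤ.+ coeff d k                                   ≡⟨ cong₂ ℤ._+_ (trans (a≈ k) (coeff-mono-*L c N a′ k)) (trans (d≈ k) (coeff-mono-*L c N d′ k)) ⟩
  c ℤ.* coeff a′ (k ℤ.- N) ℤ.+ c ℤ.* coeff d′ (k ℤ.- N)     ≡⟨ ℤP.*-distribˡ-+ c _ _ ⟨
  c ℤ.* (coeff a′ (k ℤ.- N) ℤ.+ coeff d′ (k ℤ.- N))         ≡⟨ cong (c ℤ.*_) (coeff-+L a′ d′ (k ℤ.- N)) ⟨
  c ℤ.* coeff (a′ +L d′) (k ℤ.- N)                          ≡⟨ coeff-mono-*L c N (a′ +L d′) k ⟨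
  coeff (mono c N *L (a′ +L d′)) k                          ∎
  where open ≡-Reasoning

evalPoly-injective : ∀ as bs →
  (∀ n → evalPoly (fromℤ (+ suc n)) as ≡ evalPoly (fromℤ (+ suc n)) bs) →
  ∀ i → lcoeff (+ 0) as i ≡ lcoeff (+ 0) bs i
evalPoly-injective as bs same i = begin
  lcoeff (+ 0) as i                         ≡⟨ a+b≡0⇒a≡-b _ _ difference≡0 ⟩
  ℤ.- (ℤ.- lcoeff (+ 0) bs i)               ≡⟨ ℤP.neg-involutive _ ⟩
  lcoeff (+ 0) bs i                         ∎
  where
  open ≡-Reasoning
  d = padd as (map ℤ.-_ bs)
  d-vanishes : ∀ n → evalPolyℤ (+ suc n) d ≡ + 0
  d-vanishes n = fromℤ-injective (begin
    fromℤ (evalPolyℤ x d)                           ≡⟨ evalPoly-fromℤ x d ⟨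
    evalPoly (fromℤ x) d                            ≡⟨ evalPoly-padd (fromℤ x) as (map ℤ.-_ bs) ⟩
    evalPoly (fromℤ x) as + evalPoly (fromℤ x) (map ℤ.-_ bs) ≡⟨ cong₂ _+_ (same n) (evalPoly-neg (fromℤ x) bs) ⟩
    evalPoly (fromℤ x) bs + - evalPoly (fromℤ x) bs ≡⟨ ℚP.+-inverseʳ (evalPoly (fromℤ x) bs) ⟩
    0ℚ                                              ∎)
    where x = + suc n
  difference≡0 : lcoeff (+ 0) as i ℤ.+ ℤ.- lcoeff (+ 0) bs i ≡ + 0
  difference≡0 = begin
    lcoeff (+ 0) as i ℤ.+ ℤ.- lcoeff (+ 0) bs i     ≡⟨ cong (λ v → lcoeff (+ 0) as i ℤ.+ v) (lcoeff-neg bs i) ⟨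
    lcoeff (+ 0) as i ℤ.+ lcoeff (+ 0) (map ℤ.-_ bs) i ≡⟨ lcoeff-padd as (map ℤ.-_ bs) i ⟨
    lcoeff (+ 0) d i                                 ≡⟨ vanishing⇒coeff≡0 d d-vanishes i ⟩
    + 0                                              ∎

evalL-injective : ∀ x y → (∀ n → evalL (natPoint n) x ≡ evalL (natPoint n) y) → x ≈ y
evalL-injective (mkL s as) (mkL t bs) same k = begin
  coeff (mkL s as) k            ≡⟨ coeff-lowerShift as (ℤP.i⊓j≤i s t) k ⟨
  icoeff (+ 0) as′ (k ℤ.- m)    ≡⟨ icoeff-cong (k ℤ.- m) ⟩
  icoeff (+ 0) bs′ (k ℤ.- m)    ≡⟨ coeff-lowerShift bs (ℤP.i⊓j≤j s t) k ⟩
  coeff (mkL t bs) k            ∎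
  where
  open ≡-Reasoning
  m = s ℤ.⊓ t
  as′ = replicate ∣ s ℤ.- m ∣ (+ 0) ++ as
  bs′ = replicate ∣ t ℤ.- m ∣ (+ 0) ++ bs
  same′ : ∀ n → evalPoly (fromℤ (+ suc n)) as′ ≡ evalPoly (fromℤ (+ suc n)) bs′
  same′ n = ^ᶻ-cancelˡ (natPoint n) m (begin
    evalL (natPoint n) (mkL m as′) ≡⟨ evalL-lowerShift (natPoint n) as (ℤP.i⊓j≤i s t) ⟨
    evalL (natPoint n) (mkL s as)  ≡⟨ same n ⟩
    evalL (natPoint n) (mkL t bs)  ≡⟨ evalL-lowerShift (natPoint n) bs (ℤP.i⊓j≤j s t) ⟩
    evalL (natPoint n) (mkL m bs′) ∎)
  icoeff-cong : ∀ i → icoeff (+ 0) as′ i ≡ icoeff (+ 0) bs′ i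
  icoeff-cong (+ i)    = evalPoly-injective as′ bs′ same′ i
  icoeff-cong -[1+ i ] = refl

record Matℚ : Set where
  constructor matℚ
  field
    a b c d : ℚ

infixl 7 _∙_
_∙_ : Matℚ → Matℚ → Matℚ
matℚ a b c d ∙ matℚ a′ b′ c′ d′ =
  matℚ (a * a′ + b * c′) (a * b′ + b * d′) (c * a′ + d * c′) (c * b′ + d * d′)

infixr 8 _•_
_•_ : ℚ → Matℚ → Matℚ
x • matℚ a b c d = matℚ (x * a) (x * b) (x * c) (x * d)

tr : Matℚ → ℚ
tr (matℚ a b c d) = a + d

I : Matℚ
I = matℚ 1ℚ 0ℚ 0ℚ 1ℚ

matℚ-cong : ∀ {a b c d a′ b′ c′ d′} → a ≡ a′ → b ≡ b′ → c ≡ c′ → d ≡ d′ → matℚ a b c d ≡ matℚ a′ b′ c′ d′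
matℚ-cong refl refl refl refl = refl

∙-assoc : ∀ A B C → (A ∙ B) ∙ C ≡ A ∙ (B ∙ C)
∙-assoc (matℚ a b c d) (matℚ a′ b′ c′ d′) (matℚ a″ b″ c″ d″) = matℚ-cong
  (entry a b a′ b′ c′ d′ a″ c″) (entry a b a′ b′ c′ d′ b″ d″) (entry c d a′ b′ c′ d′ a″ c″) (entry c d a′ b′ c′ d′ b″ d″)
  where
  entry : ∀ x y a b c d z w → (x * a + y * c) * z + (x * b + y * d) * w ≡ x * (a * z + b * w) + y * (c * z + d * w)
  entry = solve-∀ ℚ-ring

∙-identityˡ : ∀ A → I ∙ A ≡ A
∙-identityˡ (matℚ a b c d) = matℚ-cong (lemma₁ a c) (lemma₁ b d) (lemma₂ a c) (lemma₂ b d)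
  where
  lemma₁ : ∀ x y → 1ℚ * x + 0ℚ * y ≡ x
  lemma₁ = solve-∀ ℚ-ring
  lemma₂ : ∀ x y → 0ℚ * x + 1ℚ * y ≡ y
  lemma₂ = solve-∀ ℚ-ring

∙-identityʳ : ∀ A → A ∙ I ≡ A
∙-identityʳ (matℚ a b c d) = matℚ-cong (lemma₁ a b) (lemma₂ a b) (lemma₁ c d) (lemma₂ c d)
  where
  lemma₁ : ∀ x y → x * 1ℚ + y * 0ℚ ≡ x
  lemma₁ = solve-∀ ℚ-ring
  lemma₂ : ∀ x y → x * 0ℚ + y * 1ℚ ≡ y
  lemma₂ = solve-∀ ℚ-ring

tr-∙-comm : ∀ A B → tr (A ∙ B) ≡ tr (B ∙ A)
tr-∙-comm (matℚ a b c d) (matℚ a′ b′ c′ d′) = lemma a b c d a′ b′ c′ d′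
  where
  lemma : ∀ a b c d a′ b′ c′ d′ → (a * a′ + b * c′) + (c * b′ + d * d′) ≡ (a′ * a + b′ * c) + (c′ * b + d′ * d)
  lemma = solve-∀ ℚ-ring

•-∙-assoc : ∀ x A B → (x • A) ∙ B ≡ x • (A ∙ B)
•-∙-assoc x (matℚ a b c d) (matℚ a′ b′ c′ d′) = matℚ-cong (lemma x a b a′ c′) (lemma x a b b′ d′) (lemma x c d a′ c′) (lemma x c d b′ d′)
  where
  lemma : ∀ x a b y z → (x * a) * y + (x * b) * z ≡ x * (a * y + b * z)
  lemma = solve-∀ ℚ-ring

∙-•-comm : ∀ x A B → A ∙ (x • B) ≡ x • (A ∙ B)
∙-•-comm x (matℚ a b c d) (matℚ a′ b′ c′ d′) = matℚ-cong (lemma x a b a′ c′) (lemma x a b b′ d′) (lemma x c d a′ c′) (lemma x c d b′ d′)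
  where
  lemma : ∀ x a b y z → a * (x * y) + b * (x * z) ≡ x * (a * y + b * z)
  lemma = solve-∀ ℚ-ring

•-assoc : ∀ x y A → x • (y • A) ≡ (x * y) • A
•-assoc x y (matℚ a b c d) = matℚ-cong (sym (ℚP.*-assoc x y a)) (sym (ℚP.*-assoc x y b)) (sym (ℚP.*-assoc x y c)) (sym (ℚP.*-assoc x y d))

•-identity : ∀ A → 1ℚ • A ≡ A
•-identity (matℚ a b c d) = matℚ-cong (ℚP.*-identityˡ a) (ℚP.*-identityˡ b) (ℚP.*-identityˡ c) (ℚP.*-identityˡ d)

tr-• : ∀ x A → tr (x • A) ≡ x * tr A
tr-• x (matℚ a b c d) = sym (ℚP.*-distribˡ-+ x a d)

evalM : Point → Mat → Matℚ
evalM p (mat a b c d) = matℚ (evalL p a) (evalL p b) (evalL p c) (evalL p d)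

evalM-· : ∀ p A B → evalM p (A · B) ≡ evalM p A ∙ evalM p B
evalM-· p (mat a b c d) (mat a′ b′ c′ d′) =
  matℚ-cong (entry a a′ b c′) (entry a b′ b d′) (entry c a′ d c′) (entry c b′ d d′)
  where
  entry : ∀ x y z w → evalL p (x *L y +L z *L w) ≡ evalL p x * evalL p y + evalL p z * evalL p w
  entry x y z w = trans (evalL-+L p (x *L y) (z *L w)) (cong₂ _+_ (evalL-*L p x y) (evalL-*L p z w))

evalL-trace : ∀ p A → evalL p (trace A) ≡ tr (evalM p A)
evalL-trace p (mat a b c d) = evalL-+L p a d

Unit : Set
Unit = Sign × ℤ

signℚ : Sign → ℚ
signℚ Sign.+ = 1ℚ
signℚ Sign.- = - 1ℚ

⟦_⟧ᵘ : Unit → Point → ℚ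
⟦ s , N ⟧ᵘ p = signℚ s * p ^ᶻ N

1ᵘ : Unit
1ᵘ = Sign.+ , + 0

infixl 7 _·ᵘ_
_·ᵘ_ : Unit → Unit → Unit
(s , N) ·ᵘ (t , M) = s Sign.* t , N ℤ.+ M

signℚ-* : ∀ s t → signℚ (s Sign.* t) ≡ signℚ s * signℚ t
signℚ-* Sign.+ Sign.+ = refl
signℚ-* Sign.+ Sign.- = refl
signℚ-* Sign.- Sign.+ = refl
signℚ-* Sign.- Sign.- = refl

⟦·ᵘ⟧ : ∀ u v p → ⟦ u ·ᵘ v ⟧ᵘ p ≡ ⟦ u ⟧ᵘ p * ⟦ v ⟧ᵘ p
⟦·ᵘ⟧ (s , N) (t , M) p = trans (cong₂ _*_ (signℚ-* s t) (^ᶻ-+ p N M)) (*-interchange (signℚ s) (signℚ t) (p ^ᶻ N) (p ^ᶻ M))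

evalL-unit : ∀ p s N → evalL p (unit s N) ≡ ⟦ s , N ⟧ᵘ p
evalL-unit p s N = trans (evalL-mono p (s ℤ.◃ 1) N) (trans (ℚP.*-comm (p ^ᶻ N) _) (cong (_* p ^ᶻ N) (fromℤ-◃1 s)))
  where
  fromℤ-◃1 : ∀ s → fromℤ (s ℤ.◃ 1) ≡ signℚ s
  fromℤ-◃1 Sign.+ = refl
  fromℤ-◃1 Sign.- = refl

infix 4 _∼_
_∼_ : (Point → ℚ) → (Point → ℚ) → Set
f ∼ g = Σ Unit λ u → ∀ p → f p ≡ ⟦ u ⟧ᵘ p * g p

∼-reflexive : ∀ {f g} → (∀ p → f p ≡ g p) → f ∼ g
∼-reflexive f≗g = 1ᵘ , λ p → trans (f≗g p) (sym (ℚP.*-identityˡ _))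

∼-trans : ∀ {f g h} → f ∼ g → g ∼ h → f ∼ h
∼-trans {f} {g} {h} (u , f≡ug) (v , g≡vh) = u ·ᵘ v , λ p → begin
  f p                          ≡⟨ f≡ug p ⟩
  ⟦ u ⟧ᵘ p * g p               ≡⟨ cong (⟦ u ⟧ᵘ p *_) (g≡vh p) ⟩
  ⟦ u ⟧ᵘ p * (⟦ v ⟧ᵘ p * h p)  ≡⟨ ℚP.*-assoc (⟦ u ⟧ᵘ p) _ _ ⟨
  ⟦ u ⟧ᵘ p * ⟦ v ⟧ᵘ p * h p    ≡⟨ cong (_* h p) (⟦·ᵘ⟧ u v p) ⟨
  ⟦ u ·ᵘ v ⟧ᵘ p * h p          ∎
  where open ≡-Reasoning

infix 4 _∼ᴹ_
_∼ᴹ_ : (Point → Matℚ) → (Point → Matℚ) → Set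
A ∼ᴹ B = Σ Unit λ u → ∀ p → A p ≡ ⟦ u ⟧ᵘ p • B p

∼ᴹ-reflexive : ∀ {A B} → (∀ p → A p ≡ B p) → A ∼ᴹ B
∼ᴹ-reflexive A≗B = 1ᵘ , λ p → trans (A≗B p) (sym (•-identity _))

∼ᴹ-trans : ∀ {A B C} → A ∼ᴹ B → B ∼ᴹ C → A ∼ᴹ C
∼ᴹ-trans {A} {B} {C} (u , A≡uB) (v , B≡vC) = u ·ᵘ v , λ p → begin
  A p                            ≡⟨ A≡uB p ⟩
  ⟦ u ⟧ᵘ p • B p                 ≡⟨ cong (⟦ u ⟧ᵘ p •_) (B≡vC p) ⟩
  ⟦ u ⟧ᵘ p • ⟦ v ⟧ᵘ p • C p      ≡⟨ •-assoc (⟦ u ⟧ᵘ p) (⟦ v ⟧ᵘ p) (C p) ⟩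
  (⟦ u ⟧ᵘ p * ⟦ v ⟧ᵘ p) • C p    ≡⟨ cong (_• C p) (⟦·ᵘ⟧ u v p) ⟨
  ⟦ u ·ᵘ v ⟧ᵘ p • C p            ∎
  where open ≡-Reasoning

∙-cong-∼ᴹ : ∀ {A A′ B B′} → A ∼ᴹ A′ → B ∼ᴹ B′ → (λ p → A p ∙ B p) ∼ᴹ (λ p → A′ p ∙ B′ p)
∙-cong-∼ᴹ {A} {A′} {B} {B′} (u , A≡uA′) (v , B≡vB′) = u ·ᵘ v , λ p → begin
  A p ∙ B p                              ≡⟨ cong₂ _∙_ (A≡uA′ p) (B≡vB′ p) ⟩
  (⟦ u ⟧ᵘ p • A′ p) ∙ (⟦ v ⟧ᵘ p • B′ p)  ≡⟨ •-∙-assoc (⟦ u ⟧ᵘ p) (A′ p) _ ⟩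
  ⟦ u ⟧ᵘ p • (A′ p ∙ (⟦ v ⟧ᵘ p • B′ p))  ≡⟨ cong (⟦ u ⟧ᵘ p •_) (∙-•-comm (⟦ v ⟧ᵘ p) (A′ p) (B′ p)) ⟩
  ⟦ u ⟧ᵘ p • ⟦ v ⟧ᵘ p • (A′ p ∙ B′ p)    ≡⟨ •-assoc (⟦ u ⟧ᵘ p) (⟦ v ⟧ᵘ p) _ ⟩
  (⟦ u ⟧ᵘ p * ⟦ v ⟧ᵘ p) • (A′ p ∙ B′ p)  ≡⟨ cong (_• (A′ p ∙ B′ p)) (⟦·ᵘ⟧ u v p) ⟨
  ⟦ u ·ᵘ v ⟧ᵘ p • (A′ p ∙ B′ p)          ∎
  where open ≡-Reasoning

tr-cong-∼ᴹ : ∀ {A B} → A ∼ᴹ B → (λ p → tr (A p)) ∼ (λ p → tr (B p))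
tr-cong-∼ᴹ {A} {B} (u , A≡uB) = u , λ p → trans (cong tr (A≡uB p)) (tr-• (⟦ u ⟧ᵘ p) (B p))

-1ᵘ -qᵘ -q⁻¹ᵘ : Unit
-1ᵘ   = Sign.- , + 0
-qᵘ   = Sign.- , + 1
-q⁻¹ᵘ = Sign.- , -[1+ 0 ]

Sℚ Rℚ Lℚ : Point → Matℚ
Sℚ p = matℚ 0ℚ (- q⁻¹ p) 1ℚ 0ℚ
Rℚ p = matℚ (q p) 1ℚ 0ℚ 1ℚ
Lℚ p = matℚ (q p) 0ℚ (q p) 1ℚ

-- U = R_q S_q, of order three in PSL_q(2, ℤ).
Uℚ : Matℚ
Uℚ = matℚ 1ℚ (- 1ℚ) 1ℚ 0ℚ

U∙U∙U : Uℚ ∙ (Uℚ ∙ Uℚ) ≡ signℚ Sign.- • I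
U∙U∙U = refl

by-q*q⁻¹≡1 : ∀ p {x y} (G : ℚ → ℚ) → x ≡ G (q p * q⁻¹ p) → G 1ℚ ≡ y → x ≡ y
by-q*q⁻¹≡1 p G x≡G[qq⁻¹] G[1]≡y = trans x≡G[qq⁻¹] (trans (cong G (q*q⁻¹≡1 p)) G[1]≡y)

S∙S : ∀ p → Sℚ p ∙ Sℚ p ≡ ⟦ -q⁻¹ᵘ ⟧ᵘ p • I
S∙S p = matℚ-cong (diagonal (q⁻¹ p)) (off-diagonal₁ (q⁻¹ p)) (off-diagonal₂ (q⁻¹ p)) (diagonal′ (q⁻¹ p))
  where
  diagonal : ∀ x → 0ℚ * 0ℚ + (- x) * 1ℚ ≡ (- 1ℚ * (x * 1ℚ)) * 1ℚ
  diagonal = solve-∀ ℚ-ring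
  diagonal′ : ∀ x → 1ℚ * (- x) + 0ℚ * 0ℚ ≡ (- 1ℚ * (x * 1ℚ)) * 1ℚ
  diagonal′ = solve-∀ ℚ-ring
  off-diagonal₁ : ∀ x → 0ℚ * (- x) + (- x) * 0ℚ ≡ (- 1ℚ * (x * 1ℚ)) * 0ℚ
  off-diagonal₁ = solve-∀ ℚ-ring
  off-diagonal₂ : ∀ x → 1ℚ * 0ℚ + 0ℚ * 1ℚ ≡ (- 1ℚ * (x * 1ℚ)) * 0ℚ
  off-diagonal₂ = solve-∀ ℚ-ring

U∙S : ∀ p → Uℚ ∙ Sℚ p ≡ ⟦ -q⁻¹ᵘ ⟧ᵘ p • Rℚ p
U∙S p = matℚ-cong
  (sym (by-q*q⁻¹≡1 p -_ (entry-a (q p) (q⁻¹ p)) refl))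
  (entry-bd (q⁻¹ p)) (entry-c (q⁻¹ p)) (entry-bd (q⁻¹ p))
  where
  entry-a : ∀ x y → (- 1ℚ * (y * 1ℚ)) * x ≡ - (x * y)
  entry-a = solve-∀ ℚ-ring
  entry-bd : ∀ y → 1ℚ * (- y) + (- 1ℚ) * 0ℚ ≡ (- 1ℚ * (y * 1ℚ)) * 1ℚ
  entry-bd = solve-∀ ℚ-ring
  entry-c : ∀ y → 1ℚ * 0ℚ + 0ℚ * 1ℚ ≡ (- 1ℚ * (y * 1ℚ)) * 0ℚ
  entry-c = solve-∀ ℚ-ring

U∙R : ∀ p → Uℚ ∙ Rℚ p ≡ Lℚ p
U∙R p = matℚ-cong (entry-ac (q p)) refl (entry-ac (q p)) refl
  where
  entry-ac : ∀ x → 1ℚ * x + (- 1ℚ) * 0ℚ ≡ x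
  entry-ac = solve-∀ ℚ-ring

U∙U∙S : ∀ p → Uℚ ∙ (Uℚ ∙ Sℚ p) ≡ ⟦ -q⁻¹ᵘ ⟧ᵘ p • Lℚ p
U∙U∙S p = begin
  Uℚ ∙ (Uℚ ∙ Sℚ p)                 ≡⟨ cong (Uℚ ∙_) (U∙S p) ⟩
  Uℚ ∙ (⟦ -q⁻¹ᵘ ⟧ᵘ p • Rℚ p)        ≡⟨ ∙-•-comm (⟦ -q⁻¹ᵘ ⟧ᵘ p) Uℚ (Rℚ p) ⟩
  ⟦ -q⁻¹ᵘ ⟧ᵘ p • (Uℚ ∙ Rℚ p)        ≡⟨ cong (⟦ -q⁻¹ᵘ ⟧ᵘ p •_) (U∙R p) ⟩
  ⟦ -q⁻¹ᵘ ⟧ᵘ p • Lℚ p               ∎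
  where open ≡-Reasoning

evalL-0L : ∀ p → evalL p 0L ≡ 0ℚ
evalL-0L p = trans (evalL-mono p (+ 0) (+ 0)) (ℚP.*-zeroʳ 1ℚ)

evalL-1L : ∀ p → evalL p 1L ≡ 1ℚ
evalL-1L p = evalL-mono p (+ 1) (+ 0)

evalL-±q : ∀ p c → evalL p (mono c (+ 1)) ≡ q p * fromℤ c
evalL-±q p c = trans (evalL-mono p c (+ 1)) (cong (_* fromℤ c) (ℚP.*-identityʳ (q p)))

evalL-±q⁻¹ : ∀ p c → evalL p (mono c -[1+ 0 ]) ≡ q⁻¹ p * fromℤ c
evalL-±q⁻¹ p c = trans (evalL-mono p c -[1+ 0 ]) (cong (_* fromℤ c) (ℚP.*-identityʳ (q⁻¹ p)))

x*-1≡-x : ∀ x → x * - 1ℚ ≡ - x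
x*-1≡-x = solve-∀ ℚ-ring

⟦-q⟧*⟦-q⁻¹⟧≡1 : ∀ p → ⟦ -qᵘ ⟧ᵘ p * ⟦ -q⁻¹ᵘ ⟧ᵘ p ≡ 1ℚ
⟦-q⟧*⟦-q⁻¹⟧≡1 p = by-q*q⁻¹≡1 p (λ z → z) (regroup (q p) (q⁻¹ p)) refl
  where
  regroup : ∀ x y → (- 1ℚ * (x * 1ℚ)) * (- 1ℚ * (y * 1ℚ)) ≡ x * y
  regroup = solve-∀ ℚ-ring

R≡-q•U∙S : ∀ p → Rℚ p ≡ ⟦ -qᵘ ⟧ᵘ p • (Uℚ ∙ Sℚ p)
R≡-q•U∙S p = sym (begin
  ⟦ -qᵘ ⟧ᵘ p • (Uℚ ∙ Sℚ p)                 ≡⟨ cong (⟦ -qᵘ ⟧ᵘ p •_) (U∙S p) ⟩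
  ⟦ -qᵘ ⟧ᵘ p • ⟦ -q⁻¹ᵘ ⟧ᵘ p • Rℚ p          ≡⟨ •-assoc (⟦ -qᵘ ⟧ᵘ p) (⟦ -q⁻¹ᵘ ⟧ᵘ p) (Rℚ p) ⟩
  (⟦ -qᵘ ⟧ᵘ p * ⟦ -q⁻¹ᵘ ⟧ᵘ p) • Rℚ p       ≡⟨ cong (_• Rℚ p) (⟦-q⟧*⟦-q⁻¹⟧≡1 p) ⟩
  1ℚ • Rℚ p                                ≡⟨ •-identity (Rℚ p) ⟩
  Rℚ p                                     ∎)
  where open ≡-Reasoning

R⁻¹≡-S∙U∙U : ∀ p → matℚ (q⁻¹ p) (- q⁻¹ p) 0ℚ 1ℚ ≡ ⟦ -1ᵘ ⟧ᵘ p • (Sℚ p ∙ (Uℚ ∙ Uℚ))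
R⁻¹≡-S∙U∙U p = matℚ-cong (entry-a (q⁻¹ p)) (entry-b (q⁻¹ p)) refl refl
  where
  entry-a : ∀ y → y ≡ - 1ℚ * (0ℚ * 0ℚ + (- y) * 1ℚ)
  entry-a = solve-∀ ℚ-ring
  entry-b : ∀ y → - y ≡ - 1ℚ * (0ℚ * (- 1ℚ) + (- y) * (- 1ℚ))
  entry-b = solve-∀ ℚ-ring

S⁻¹≡-q•S : ∀ p → matℚ 0ℚ 1ℚ (- q p) 0ℚ ≡ ⟦ -qᵘ ⟧ᵘ p • Sℚ p
S⁻¹≡-q•S p = matℚ-cong (zero-entry (q p)) (sym (by-q*q⁻¹≡1 p (λ z → z) (entry-b (q p) (q⁻¹ p)) refl))
                       (entry-c (q p)) (zero-entry (q p))
  where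
  zero-entry : ∀ x → 0ℚ ≡ (- 1ℚ * (x * 1ℚ)) * 0ℚ
  zero-entry = solve-∀ ℚ-ring
  entry-b : ∀ x y → (- 1ℚ * (x * 1ℚ)) * (- y) ≡ x * y
  entry-b = solve-∀ ℚ-ring
  entry-c : ∀ x → - x ≡ (- 1ℚ * (x * 1ℚ)) * 1ℚ
  entry-c = solve-∀ ℚ-ring

U^ : ℕ → Matℚ
U^ zero    = I
U^ (suc n) = Uℚ ∙ U^ n

U^-+ : ∀ m n → U^ (m ℕ.+ n) ≡ U^ m ∙ U^ n
U^-+ zero    n = sym (∙-identityˡ (U^ n))
U^-+ (suc m) n = trans (cong (Uℚ ∙_) (U^-+ m n)) (sym (∙-assoc Uℚ (U^ m) (U^ n)))

block : Point → ℕ → Matℚ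
block p c = U^ c ∙ Sℚ p

blocks : Point → List ℕ → Matℚ
blocks p []       = I
blocks p (c ∷ cs) = block p c ∙ blocks p cs

blocks-++ : ∀ p xs ys → blocks p (xs ++ ys) ≡ blocks p xs ∙ blocks p ys
blocks-++ p []       ys = sym (∙-identityˡ (blocks p ys))
blocks-++ p (x ∷ xs) ys = trans (cong (block p x ∙_) (blocks-++ p xs ys)) (sym (∙-assoc (block p x) (blocks p xs) (blocks p ys)))

-- The word ∏ᵢ (U^{cᵢ} S) · U^t; every word in S and U has exactly one such form.
record SUWord : Set where
  constructor _⁏_
  field
    exponents : List ℕ
    tail      : ℕ

⟦_⟧ʷ : SUWord → Point → Matℚ
⟦ cs ⁏ t ⟧ʷ p = blocks p cs ∙ U^ t

S∷_ U∷_ : SUWord → SUWord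
S∷ (cs ⁏ t)       = (0 ∷ cs) ⁏ t
U∷ ([] ⁏ t)       = [] ⁏ suc t
U∷ ((c ∷ cs) ⁏ t) = (suc c ∷ cs) ⁏ t

⟦S∷⟧ : ∀ p w → Sℚ p ∙ ⟦ w ⟧ʷ p ≡ ⟦ S∷ w ⟧ʷ p
⟦S∷⟧ p (cs ⁏ t) = begin
  Sℚ p ∙ (blocks p cs ∙ U^ t)           ≡⟨ ∙-assoc (Sℚ p) (blocks p cs) (U^ t) ⟨
  (Sℚ p ∙ blocks p cs) ∙ U^ t           ≡⟨ cong (λ X → (X ∙ blocks p cs) ∙ U^ t) (∙-identityˡ (Sℚ p)) ⟨
  (block p 0 ∙ blocks p cs) ∙ U^ t      ∎
  where open ≡-Reasoning

⟦U∷⟧ : ∀ p w → Uℚ ∙ ⟦ w ⟧ʷ p ≡ ⟦ U∷ w ⟧ʷ p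
⟦U∷⟧ p ([] ⁏ t) = begin
  Uℚ ∙ (I ∙ U^ t)        ≡⟨ cong (Uℚ ∙_) (∙-identityˡ (U^ t)) ⟩
  Uℚ ∙ U^ t              ≡⟨ ∙-identityˡ (Uℚ ∙ U^ t) ⟨
  I ∙ (Uℚ ∙ U^ t)        ∎
  where open ≡-Reasoning
⟦U∷⟧ p ((c ∷ cs) ⁏ t) = begin
  Uℚ ∙ ((U^ c ∙ Sℚ p ∙ blocks p cs) ∙ U^ t)      ≡⟨ ∙-assoc Uℚ (block p c ∙ blocks p cs) (U^ t) ⟨
  (Uℚ ∙ (U^ c ∙ Sℚ p ∙ blocks p cs)) ∙ U^ t      ≡⟨ cong (_∙ U^ t) (∙-assoc Uℚ (block p c) (blocks p cs)) ⟨
  (Uℚ ∙ (U^ c ∙ Sℚ p) ∙ blocks p cs) ∙ U^ t      ≡⟨ cong (λ X → X ∙ blocks p cs ∙ U^ t) (∙-assoc Uℚ (U^ c) (Sℚ p)) ⟨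
  (Uℚ ∙ U^ c ∙ Sℚ p ∙ blocks p cs) ∙ U^ t        ∎
  where open ≡-Reasoning

genUnit : Gen → Unit
genUnit R   = -qᵘ
genUnit R⁻¹ = -1ᵘ
genUnit S   = 1ᵘ
genUnit S⁻¹ = -qᵘ

genSUℚ : Gen → Point → Matℚ
genSUℚ R   p = Uℚ ∙ Sℚ p
genSUℚ R⁻¹ p = Sℚ p ∙ (Uℚ ∙ Uℚ)
genSUℚ S   p = Sℚ p
genSUℚ S⁻¹ p = Sℚ p

genSU : Gen → SUWord → SUWord
genSU R   w = U∷ S∷ w
genSU R⁻¹ w = S∷ U∷ U∷ w
genSU S   w = S∷ w
genSU S⁻¹ w = S∷ w

evalM-genMat : ∀ g p → evalM p (genMat g) ≡ ⟦ genUnit g ⟧ᵘ p • genSUℚ g p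
evalM-genMat R   p = trans (matℚ-cong (trans (evalL-±q p (+ 1)) (ℚP.*-identityʳ (q p))) (evalL-1L p) (evalL-0L p) (evalL-1L p))
                           (R≡-q•U∙S p)
evalM-genMat R⁻¹ p = trans (matℚ-cong (trans (evalL-±q⁻¹ p (+ 1)) (ℚP.*-identityʳ (q⁻¹ p)))
                                      (trans (evalL-±q⁻¹ p (ℤ.- + 1)) (x*-1≡-x (q⁻¹ p))) (evalL-0L p) (evalL-1L p))
                           (R⁻¹≡-S∙U∙U p)
evalM-genMat S   p = trans (matℚ-cong (evalL-0L p) (trans (evalL-±q⁻¹ p (ℤ.- + 1)) (x*-1≡-x (q⁻¹ p))) (evalL-1L p) (evalL-0L p))
                           (sym (•-identity (Sℚ p)))
evalM-genMat S⁻¹ p = trans (matℚ-cong (evalL-0L p) (evalL-1L p) (trans (evalL-±q p (ℤ.- + 1)) (x*-1≡-x (q p))) (evalL-0L p))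
                           (S⁻¹≡-q•S p)

genSUℚ-acts : ∀ g p w → genSUℚ g p ∙ ⟦ w ⟧ʷ p ≡ ⟦ genSU g w ⟧ʷ p
genSUℚ-acts R p w = begin
  (Uℚ ∙ Sℚ p) ∙ ⟦ w ⟧ʷ p      ≡⟨ ∙-assoc Uℚ (Sℚ p) (⟦ w ⟧ʷ p) ⟩
  Uℚ ∙ (Sℚ p ∙ ⟦ w ⟧ʷ p)      ≡⟨ cong (Uℚ ∙_) (⟦S∷⟧ p w) ⟩
  Uℚ ∙ ⟦ S∷ w ⟧ʷ p            ≡⟨ ⟦U∷⟧ p (S∷ w) ⟩
  ⟦ U∷ S∷ w ⟧ʷ p              ∎
  where open ≡-Reasoning
genSUℚ-acts R⁻¹ p w = begin
  (Sℚ p ∙ (Uℚ ∙ Uℚ)) ∙ ⟦ w ⟧ʷ p    ≡⟨ ∙-assoc (Sℚ p) (Uℚ ∙ Uℚ) (⟦ w ⟧ʷ p) ⟩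
  Sℚ p ∙ ((Uℚ ∙ Uℚ) ∙ ⟦ w ⟧ʷ p)    ≡⟨ cong (Sℚ p ∙_) (∙-assoc Uℚ Uℚ (⟦ w ⟧ʷ p)) ⟩
  Sℚ p ∙ (Uℚ ∙ (Uℚ ∙ ⟦ w ⟧ʷ p))    ≡⟨ cong (λ X → Sℚ p ∙ (Uℚ ∙ X)) (⟦U∷⟧ p w) ⟩
  Sℚ p ∙ (Uℚ ∙ ⟦ U∷ w ⟧ʷ p)        ≡⟨ cong (Sℚ p ∙_) (⟦U∷⟧ p (U∷ w)) ⟩
  Sℚ p ∙ ⟦ U∷ U∷ w ⟧ʷ p            ≡⟨ ⟦S∷⟧ p (U∷ U∷ w) ⟩
  ⟦ S∷ U∷ U∷ w ⟧ʷ p                ∎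
  where open ≡-Reasoning
genSUℚ-acts S   p w = ⟦S∷⟧ p w
genSUℚ-acts S⁻¹ p w = ⟦S∷⟧ p w

wordSU : List Gen → SUWord
wordSU []      = [] ⁏ 0
wordSU (g ∷ w) = genSU g (wordSU w)

wordUnit : List Gen → Unit
wordUnit []      = 1ᵘ
wordUnit (g ∷ w) = genUnit g ·ᵘ wordUnit w

evalM-Id : ∀ p → evalM p Id ≡ I
evalM-Id p = matℚ-cong (evalL-1L p) (evalL-0L p) (evalL-0L p) (evalL-1L p)

evalM-evalWord : ∀ p w → evalM p (evalWord w) ≡ ⟦ wordUnit w ⟧ᵘ p • ⟦ wordSU w ⟧ʷ p
evalM-evalWord p []      = trans (evalM-Id p) (sym (trans (•-identity (I ∙ I)) (∙-identityˡ I)))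
evalM-evalWord p (g ∷ w) = begin
  evalM p (genMat g · evalWord w)                 ≡⟨ evalM-· p (genMat g) (evalWord w) ⟩
  evalM p (genMat g) ∙ evalM p (evalWord w)       ≡⟨ cong₂ _∙_ (evalM-genMat g p) (evalM-evalWord p w) ⟩
  (x • genSUℚ g p) ∙ (y • ⟦ wordSU w ⟧ʷ p)        ≡⟨ •-∙-assoc x (genSUℚ g p) _ ⟩
  x • (genSUℚ g p ∙ (y • ⟦ wordSU w ⟧ʷ p))        ≡⟨ cong (x •_) (∙-•-comm y (genSUℚ g p) _) ⟩
  x • y • (genSUℚ g p ∙ ⟦ wordSU w ⟧ʷ p)          ≡⟨ •-assoc x y _ ⟩
  (x * y) • (genSUℚ g p ∙ ⟦ wordSU w ⟧ʷ p)        ≡⟨ cong₂ _•_ (sym (⟦·ᵘ⟧ (genUnit g) (wordUnit w) p)) (genSUℚ-acts g p (wordSU w)) ⟩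
  ⟦ wordUnit (g ∷ w) ⟧ᵘ p • ⟦ wordSU (g ∷ w) ⟧ʷ p ∎
  where
  open ≡-Reasoning
  x = ⟦ genUnit g ⟧ᵘ p
  y = ⟦ wordUnit w ⟧ᵘ p

-- Cyclic reduction of traces

data Residue₃ : Set where
  r₀ r₁ r₂ : Residue₃

next₃ : Residue₃ → Residue₃
next₃ r₀ = r₁
next₃ r₁ = r₂
next₃ r₂ = r₀

mod₃ : ℕ → Residue₃
mod₃ zero    = r₀
mod₃ (suc n) = next₃ (mod₃ n)

toℕ₃ : Residue₃ → ℕ
toℕ₃ r₀ = 0
toℕ₃ r₁ = 1
toℕ₃ r₂ = 2

U∙U^toℕ₃ : ∀ r → Σ Sign λ s → Uℚ ∙ U^ (toℕ₃ r) ≡ signℚ s • U^ (toℕ₃ (next₃ r))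
U∙U^toℕ₃ r₀ = Sign.+ , sym (•-identity (Uℚ ∙ I))
U∙U^toℕ₃ r₁ = Sign.+ , sym (•-identity (Uℚ ∙ (Uℚ ∙ I)))
U∙U^toℕ₃ r₂ = Sign.- , trans (cong (λ X → Uℚ ∙ (Uℚ ∙ X)) (∙-identityʳ Uℚ)) (U∙U∙U)

U^-mod₃ : ∀ n → Σ Sign λ s → U^ n ≡ signℚ s • U^ (toℕ₃ (mod₃ n))
U^-mod₃ zero    = Sign.+ , sym (•-identity I)
U^-mod₃ (suc n) with U^-mod₃ n | U∙U^toℕ₃ (mod₃ n)
... | s , Uⁿ≡ | t , U∙Uʳ≡ = s Sign.* t , (begin
  Uℚ ∙ U^ n                                    ≡⟨ cong (Uℚ ∙_) Uⁿ≡ ⟩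
  Uℚ ∙ (signℚ s • U^ (toℕ₃ r))                 ≡⟨ ∙-•-comm (signℚ s) Uℚ (U^ (toℕ₃ r)) ⟩
  signℚ s • (Uℚ ∙ U^ (toℕ₃ r))                 ≡⟨ cong (signℚ s •_) U∙Uʳ≡ ⟩
  signℚ s • signℚ t • U^ (toℕ₃ (next₃ r))      ≡⟨ •-assoc (signℚ s) (signℚ t) _ ⟩
  (signℚ s * signℚ t) • U^ (toℕ₃ (next₃ r))    ≡⟨ cong (_• U^ (toℕ₃ (next₃ r))) (signℚ-* s t) ⟨
  signℚ (s Sign.* t) • U^ (toℕ₃ (next₃ r))     ∎)
  where
  open ≡-Reasoning
  r = mod₃ n

U^∼U^mod₃ : ∀ n → (λ _ → U^ n) ∼ᴹ (λ _ → U^ (toℕ₃ (mod₃ n)))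
U^∼U^mod₃ n = lift (U^-mod₃ n)
  where
  lift : (Σ Sign λ s → U^ n ≡ signℚ s • U^ (toℕ₃ (mod₃ n))) → (λ _ → U^ n) ∼ᴹ (λ _ → U^ (toℕ₃ (mod₃ n)))
  lift (s , Uⁿ≡) = (s , + 0) , λ _ → trans Uⁿ≡ (cong (_• U^ (toℕ₃ (mod₃ n))) (sym (ℚP.*-identityʳ (signℚ s))))

data Letter : Set where
  Rˡ Lˡ : Letter

letterℚ : Letter → Point → Matℚ
letterℚ Rˡ = Rℚ
letterℚ Lˡ = Lℚ

positiveWord : List Letter → Point → Matℚ
positiveWord []       p = I
positiveWord (l ∷ ls) p = letterℚ l p ∙ positiveWord ls p

block-mod₃ : ∀ c → (λ p → block p c) ∼ᴹ (λ p → U^ (toℕ₃ (mod₃ c)) ∙ Sℚ p)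
block-mod₃ c = ∙-cong-∼ᴹ (U^∼U^mod₃ c) (∼ᴹ-reflexive (λ _ → refl))

block-r₀ : ∀ c → mod₃ c ≡ r₀ → (λ p → block p c) ∼ᴹ Sℚ
block-r₀ c c≡0 = ∼ᴹ-trans (block-mod₃ c) (∼ᴹ-reflexive (λ p → trans (cong (λ r → U^ (toℕ₃ r) ∙ Sℚ p) c≡0) (∙-identityˡ (Sℚ p))))

block-r₁ : ∀ c → mod₃ c ≡ r₁ → (λ p → block p c) ∼ᴹ Rℚ
block-r₁ c c≡1 = ∼ᴹ-trans (block-mod₃ c) (-q⁻¹ᵘ , λ p → trans (cong (λ r → U^ (toℕ₃ r) ∙ Sℚ p) c≡1)
                                                          (trans (cong (_∙ Sℚ p) (∙-identityʳ Uℚ)) (U∙S p)))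

block-r₂ : ∀ c → mod₃ c ≡ r₂ → (λ p → block p c) ∼ᴹ Lℚ
block-r₂ c c≡2 = ∼ᴹ-trans (block-mod₃ c) (-q⁻¹ᵘ , λ p → trans (cong (λ r → U^ (toℕ₃ r) ∙ Sℚ p) c≡2)
                                                          (trans (U²∙S p) (U∙U∙S p)))
  where
  U²∙S : ∀ p → U^ 2 ∙ Sℚ p ≡ Uℚ ∙ (Uℚ ∙ Sℚ p)
  U²∙S p = trans (cong (λ X → Uℚ ∙ X ∙ Sℚ p) (∙-identityʳ Uℚ)) (∙-assoc Uℚ Uℚ (Sℚ p))

positive-or-split : ∀ cs →
  (Σ (List Letter) λ ls → (λ p → blocks p cs) ∼ᴹ positiveWord ls) ⊎
  (∃ λ xs → ∃ λ z → ∃ λ ys → cs ≡ xs ++ z ∷ ys × mod₃ z ≡ r₀)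
positive-or-split []       = inj₁ ([] , ∼ᴹ-reflexive (λ _ → refl))
positive-or-split (c ∷ cs) with mod₃ c in c≡ | positive-or-split cs
... | r₀ | _                          = inj₂ ([] , c , cs , refl , c≡)
... | r₁ | inj₁ (ls , cs∼)            = inj₁ (Rˡ ∷ ls , ∙-cong-∼ᴹ (block-r₁ c c≡) cs∼)
... | r₂ | inj₁ (ls , cs∼)            = inj₁ (Lˡ ∷ ls , ∙-cong-∼ᴹ (block-r₂ c c≡) cs∼)
... | r₁ | inj₂ (xs , z , ys , eq , z≡) = inj₂ (c ∷ xs , z , ys , cong (c ∷_) eq , z≡)
... | r₂ | inj₂ (xs , z , ys , eq , z≡) = inj₂ (c ∷ xs , z , ys , cong (c ∷_) eq , z≡)

data Shape : Set where
  trace-zero trace-one : Shape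
  positive             : List Letter → Shape

shapeTrace : Shape → Point → ℚ
shapeTrace trace-zero    p = 0ℚ
shapeTrace trace-one     p = 1ℚ
shapeTrace (positive ls) p = tr (positiveWord ls p)

HasShape : (Point → ℚ) → Set
HasShape f = Σ Shape λ sh → f ∼ shapeTrace sh

HasShape-∼ : ∀ {f g} → f ∼ g → HasShape g → HasShape f
HasShape-∼ f∼g (sh , g∼sh) = sh , ∼-trans f∼g g∼sh

trace-U^ : ∀ e → HasShape (λ _ → tr (U^ e))
trace-U^ e = HasShape-∼ (tr-cong-∼ᴹ (U^∼U^mod₃ e)) (residue-shape (mod₃ e))
  where
  residue-shape : ∀ r → HasShape (λ _ → tr (U^ (toℕ₃ r)))
  residue-shape r₀ = positive [] , ∼-reflexive (λ _ → refl)
  residue-shape r₁ = trace-one , ∼-reflexive (λ _ → refl)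
  residue-shape r₂ = trace-one , -1ᵘ , λ _ → refl

ShapedBelow : ℕ → Set
ShapedBelow n = ∀ cs → length cs ℕ.< n → HasShape (λ p → tr (blocks p cs))

trace-U^∙blocks : ∀ {n} → ShapedBelow n → ∀ e ds → length ds ℕ.< n → HasShape (λ p → tr (U^ e ∙ blocks p ds))
trace-U^∙blocks shaped e []       _   = HasShape-∼ (∼-reflexive (λ _ → cong tr (∙-identityʳ (U^ e)))) (trace-U^ e)
trace-U^∙blocks shaped e (f ∷ ds) len = HasShape-∼ (∼-reflexive (λ p → cong tr (merge p))) (shaped ((e ℕ.+ f) ∷ ds) len)
  where
  merge : ∀ p → U^ e ∙ (U^ f ∙ Sℚ p ∙ blocks p ds) ≡ U^ (e ℕ.+ f) ∙ Sℚ p ∙ blocks p ds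
  merge p = begin
    U^ e ∙ (U^ f ∙ Sℚ p ∙ blocks p ds)     ≡⟨ ∙-assoc (U^ e) (block p f) (blocks p ds) ⟨
    U^ e ∙ (U^ f ∙ Sℚ p) ∙ blocks p ds     ≡⟨ cong (_∙ blocks p ds) (∙-assoc (U^ e) (U^ f) (Sℚ p)) ⟨
    U^ e ∙ U^ f ∙ Sℚ p ∙ blocks p ds       ≡⟨ cong (λ X → X ∙ Sℚ p ∙ blocks p ds) (U^-+ e f) ⟨
    U^ (e ℕ.+ f) ∙ Sℚ p ∙ blocks p ds      ∎
    where open ≡-Reasoning

blocks∷ʳ∙S : ∀ p ds e → blocks p (ds ∷ʳ e) ∙ Sℚ p ≡ ⟦ -q⁻¹ᵘ ⟧ᵘ p • (blocks p ds ∙ U^ e)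
blocks∷ʳ∙S p ds e = begin
  blocks p (ds ∷ʳ e) ∙ Sℚ p                  ≡⟨ cong (_∙ Sℚ p) (blocks-++ p ds (e ∷ [])) ⟩
  blocks p ds ∙ (block p e ∙ I) ∙ Sℚ p       ≡⟨ cong (λ X → blocks p ds ∙ X ∙ Sℚ p) (∙-identityʳ (block p e)) ⟩
  blocks p ds ∙ (U^ e ∙ Sℚ p) ∙ Sℚ p         ≡⟨ ∙-assoc (blocks p ds) (block p e) (Sℚ p) ⟩
  blocks p ds ∙ (U^ e ∙ Sℚ p ∙ Sℚ p)         ≡⟨ cong (blocks p ds ∙_) (∙-assoc (U^ e) (Sℚ p) (Sℚ p)) ⟩
  blocks p ds ∙ (U^ e ∙ (Sℚ p ∙ Sℚ p))       ≡⟨ cong (λ X → blocks p ds ∙ (U^ e ∙ X)) (S∙S p) ⟩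
  blocks p ds ∙ (U^ e ∙ (c • I))             ≡⟨ cong (blocks p ds ∙_) (∙-•-comm c (U^ e) I) ⟩
  blocks p ds ∙ (c • (U^ e ∙ I))             ≡⟨ cong (λ X → blocks p ds ∙ (c • X)) (∙-identityʳ (U^ e)) ⟩
  blocks p ds ∙ (c • U^ e)                   ≡⟨ ∙-•-comm c (blocks p ds) (U^ e) ⟩
  c • (blocks p ds ∙ U^ e)                   ∎
  where
  open ≡-Reasoning
  c = ⟦ -q⁻¹ᵘ ⟧ᵘ p

trace-blocks∙S : ∀ {n} → ShapedBelow n → ∀ ds → length ds ℕ.< n → HasShape (λ p → tr (blocks p ds ∙ Sℚ p))
trace-blocks∙S shaped ds len with initLast ds
... | []        = trace-zero , ∼-reflexive (λ p → cong tr (∙-identityˡ (Sℚ p)))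
... | ds′ ∷ʳ′ e = HasShape-∼ cancel-S∙S (trace-U^∙blocks shaped e ds′ (ℕP.<-trans (shorter ds′ e) len))
  where
  cancel-S∙S : (λ p → tr (blocks p (ds′ ∷ʳ e) ∙ Sℚ p)) ∼ (λ p → tr (U^ e ∙ blocks p ds′))
  cancel-S∙S = ∼-trans (tr-cong-∼ᴹ (-q⁻¹ᵘ , λ p → blocks∷ʳ∙S p ds′ e)) (∼-reflexive (λ p → tr-∙-comm (blocks p ds′) (U^ e)))
  shorter : ∀ (xs : List ℕ) x → length xs ℕ.< length (xs ∷ʳ x)
  shorter xs x = ℕP.≤-reflexive (trans (ℕP.+-comm 1 (length xs)) (sym (LP.length-++ xs)))

-- A block U^z S with z ≡ 0 (mod 3) is ±S; rotating it to the end puts S next to the last block, where S² is a unit.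
trace-blocks : ∀ n → ShapedBelow n
trace-blocks zero    cs ()
trace-blocks (suc n) cs (ℕ.s≤s len) with positive-or-split cs
... | inj₁ (ls , cs∼ls)                = positive ls , tr-cong-∼ᴹ cs∼ls
... | inj₂ (xs , z , ys , refl , z≡0) =
  HasShape-∼ rotate (trace-blocks∙S (trace-blocks n) (ys ++ xs) (ℕP.<-≤-trans shorter len))
  where
  rotate : (λ p → tr (blocks p (xs ++ z ∷ ys))) ∼ (λ p → tr (blocks p (ys ++ xs) ∙ Sℚ p))
  rotate = ∼-trans (∼-reflexive cycle)
          (∼-trans (tr-cong-∼ᴹ (∙-cong-∼ᴹ (block-r₀ z z≡0) (∼ᴹ-reflexive (λ _ → refl))))
                   (∼-reflexive (λ p → tr-∙-comm (Sℚ p) (blocks p (ys ++ xs)))))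
    where
    cycle : ∀ p → tr (blocks p (xs ++ z ∷ ys)) ≡ tr (block p z ∙ blocks p (ys ++ xs))
    cycle p = begin
      tr (blocks p (xs ++ z ∷ ys))                  ≡⟨ cong tr (blocks-++ p xs (z ∷ ys)) ⟩
      tr (blocks p xs ∙ (block p z ∙ blocks p ys))  ≡⟨ tr-∙-comm (blocks p xs) _ ⟩
      tr (block p z ∙ blocks p ys ∙ blocks p xs)    ≡⟨ cong tr (∙-assoc (block p z) (blocks p ys) (blocks p xs)) ⟩
      tr (block p z ∙ (blocks p ys ∙ blocks p xs))  ≡⟨ cong (λ X → tr (block p z ∙ X)) (blocks-++ p ys xs) ⟨
      tr (block p z ∙ blocks p (ys ++ xs))          ∎
      where open ≡-Reasoning
  shorter : length (ys ++ xs) ℕ.< length (xs ++ z ∷ ys)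
  shorter = ℕP.≤-reflexive (begin
    suc (length (ys ++ xs))           ≡⟨ cong suc (LP.length-++ ys) ⟩
    suc (length ys ℕ.+ length xs)     ≡⟨ cong suc (ℕP.+-comm (length ys) (length xs)) ⟩
    suc (length xs ℕ.+ length ys)     ≡⟨ ℕP.+-suc (length xs) (length ys) ⟨
    length xs ℕ.+ length (z ∷ ys)     ≡⟨ LP.length-++ xs ⟨
    length (xs ++ z ∷ ys)             ∎)
    where open ≡-Reasoning

trace-SUWord : ∀ w → HasShape (λ p → tr (⟦ w ⟧ʷ p))
trace-SUWord (cs ⁏ t) = HasShape-∼ (∼-reflexive (λ p → tr-∙-comm (blocks p cs) (U^ t)))
                                   (trace-U^∙blocks (trace-blocks (suc (length cs))) t cs ℕP.≤-refl)

-- Positive words have entries in ℕ[q]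

paddℕ : List ℕ → List ℕ → List ℕ
paddℕ []       bs       = bs
paddℕ (a ∷ as) []       = a ∷ as
paddℕ (a ∷ as) (b ∷ bs) = (a ℕ.+ b) ∷ paddℕ as bs

pmulℕ : List ℕ → List ℕ → List ℕ
pmulℕ []       bs = []
pmulℕ (a ∷ as) bs = paddℕ (map (a ℕ.*_) bs) (0 ∷ pmulℕ as bs)

map-+-paddℕ : ∀ as bs → map +_ (paddℕ as bs) ≡ padd (map +_ as) (map +_ bs)
map-+-paddℕ []       bs       = refl
map-+-paddℕ (a ∷ as) []       = refl
map-+-paddℕ (a ∷ as) (b ∷ bs) = cong (+ (a ℕ.+ b) ∷_) (map-+-paddℕ as bs)

map-+-scaleℕ : ∀ a bs → map +_ (map (a ℕ.*_) bs) ≡ map (+ a ℤ.*_) (map +_ bs)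
map-+-scaleℕ a []       = refl
map-+-scaleℕ a (b ∷ bs) = cong₂ _∷_ (ℤP.pos-* a b) (map-+-scaleℕ a bs)

map-+-pmulℕ : ∀ as bs → map +_ (pmulℕ as bs) ≡ pmul (map +_ as) (map +_ bs)
map-+-pmulℕ []       bs = refl
map-+-pmulℕ (a ∷ as) bs = trans (map-+-paddℕ (map (a ℕ.*_) bs) (0 ∷ pmulℕ as bs))
  (cong₂ padd (map-+-scaleℕ a bs) (cong (+ 0 ∷_) (map-+-pmulℕ as bs)))

evalPolyℕ : ℚ → List ℕ → ℚ
evalPolyℕ x as = evalPoly x (map +_ as)

evalPolyℕ-paddℕ : ∀ x as bs → evalPolyℕ x (paddℕ as bs) ≡ evalPolyℕ x as + evalPolyℕ x bs
evalPolyℕ-paddℕ x as bs = trans (cong (evalPoly x) (map-+-paddℕ as bs)) (evalPoly-padd x (map +_ as) (map +_ bs))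

evalPolyℕ-pmulℕ : ∀ x as bs → evalPolyℕ x (pmulℕ as bs) ≡ evalPolyℕ x as * evalPolyℕ x bs
evalPolyℕ-pmulℕ x as bs = trans (cong (evalPoly x) (map-+-pmulℕ as bs)) (evalPoly-pmul x (map +_ as) (map +_ bs))

record Matℕ : Set where
  constructor matℕ
  field
    a b c d : List ℕ

infixl 7 _∙ℕ_
_∙ℕ_ : Matℕ → Matℕ → Matℕ
matℕ a b c d ∙ℕ matℕ a′ b′ c′ d′ =
  matℕ (paddℕ (pmulℕ a a′) (pmulℕ b c′)) (paddℕ (pmulℕ a b′) (pmulℕ b d′))
       (paddℕ (pmulℕ c a′) (pmulℕ d c′)) (paddℕ (pmulℕ c b′) (pmulℕ d d′))

trℕ : Matℕ → List ℕ
trℕ (matℕ a b c d) = paddℕ a d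

evalMℕ : ℚ → Matℕ → Matℚ
evalMℕ x (matℕ a b c d) = matℚ (evalPolyℕ x a) (evalPolyℕ x b) (evalPolyℕ x c) (evalPolyℕ x d)

evalMℕ-∙ℕ : ∀ x A B → evalMℕ x (A ∙ℕ B) ≡ evalMℕ x A ∙ evalMℕ x B
evalMℕ-∙ℕ x (matℕ a b c d) (matℕ a′ b′ c′ d′) =
  matℚ-cong (entry a a′ b c′) (entry a b′ b d′) (entry c a′ d c′) (entry c b′ d d′)
  where
  entry : ∀ y z u v → evalPolyℕ x (paddℕ (pmulℕ y z) (pmulℕ u v)) ≡ evalPolyℕ x y * evalPolyℕ x z + evalPolyℕ x u * evalPolyℕ x v
  entry y z u v = trans (evalPolyℕ-paddℕ x (pmulℕ y z) (pmulℕ u v)) (cong₂ _+_ (evalPolyℕ-pmulℕ x y z) (evalPolyℕ-pmulℕ x u v))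

letterℕ : Letter → Matℕ
letterℕ Rˡ = matℕ (0 ∷ 1 ∷ []) (1 ∷ []) [] (1 ∷ [])
letterℕ Lˡ = matℕ (0 ∷ 1 ∷ []) [] (0 ∷ 1 ∷ []) (1 ∷ [])

positiveWordℕ : List Letter → Matℕ
positiveWordℕ []       = matℕ (1 ∷ []) [] [] (1 ∷ [])
positiveWordℕ (l ∷ ls) = letterℕ l ∙ℕ positiveWordℕ ls

evalPolyℕ-1 : ∀ x → evalPolyℕ x (1 ∷ []) ≡ 1ℚ
evalPolyℕ-1 x = simplify x
  where
  simplify : ∀ x → 1ℚ + x * 0ℚ ≡ 1ℚ
  simplify = solve-∀ ℚ-ring

evalPolyℕ-X : ∀ x → evalPolyℕ x (0 ∷ 1 ∷ []) ≡ x
evalPolyℕ-X x = simplify x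
  where
  simplify : ∀ x → 0ℚ + x * (1ℚ + x * 0ℚ) ≡ x
  simplify = solve-∀ ℚ-ring

evalMℕ-positiveWordℕ : ∀ p ls → evalMℕ (q p) (positiveWordℕ ls) ≡ positiveWord ls p
evalMℕ-positiveWordℕ p []       = matℚ-cong (evalPolyℕ-1 (q p)) refl refl (evalPolyℕ-1 (q p))
evalMℕ-positiveWordℕ p (l ∷ ls) = trans (evalMℕ-∙ℕ (q p) (letterℕ l) (positiveWordℕ ls))
                                        (cong₂ _∙_ (evalMℕ-letter l) (evalMℕ-positiveWordℕ p ls))
  where
  evalMℕ-letter : ∀ l → evalMℕ (q p) (letterℕ l) ≡ letterℚ l p
  evalMℕ-letter Rˡ = matℚ-cong (evalPolyℕ-X (q p)) (evalPolyℕ-1 (q p)) refl (evalPolyℕ-1 (q p))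
  evalMℕ-letter Lˡ = matℚ-cong (evalPolyℕ-X (q p)) refl (evalPolyℕ-X (q p)) (evalPolyℕ-1 (q p))

evalPolyℕ-trℕ : ∀ p ls → evalPolyℕ (q p) (trℕ (positiveWordℕ ls)) ≡ tr (positiveWord ls p)
evalPolyℕ-trℕ p ls = trans (evalPolyℕ-paddℕ (q p) (Matℕ.a (positiveWordℕ ls)) (Matℕ.d (positiveWordℕ ls)))
                           (cong tr (evalMℕ-positiveWordℕ p ls))


-- The symmetry q ↦ q⁻¹ of positive words

-- A is the adjugate of C and δ = det C.
Cℚ Aℚ : Point → Matℚ
Cℚ p = matℚ (q p) (1ℚ - q p) (q p - 1ℚ) 1ℚ
Aℚ p = matℚ 1ℚ (q p - 1ℚ) (1ℚ - q p) (q p)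

δ : Point → ℚ
δ p = q p * q p - q p + 1ℚ

C∙A : ∀ p → Cℚ p ∙ Aℚ p ≡ δ p • I
C∙A p = matℚ-cong (entry-a (q p)) (entry-b (q p)) (entry-c (q p)) (entry-d (q p))
  where
  entry-a : ∀ x → x * 1ℚ + (1ℚ - x) * (1ℚ - x) ≡ (x * x - x + 1ℚ) * 1ℚ
  entry-a = solve-∀ ℚ-ring
  entry-b : ∀ x → x * (x - 1ℚ) + (1ℚ - x) * x ≡ (x * x - x + 1ℚ) * 0ℚ
  entry-b = solve-∀ ℚ-ring
  entry-c : ∀ x → (x - 1ℚ) * 1ℚ + 1ℚ * (1ℚ - x) ≡ (x * x - x + 1ℚ) * 0ℚ
  entry-c = solve-∀ ℚ-ring
  entry-d : ∀ x → (x - 1ℚ) * (x - 1ℚ) + 1ℚ * x ≡ (x * x - x + 1ℚ) * 1ℚ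
  entry-d = solve-∀ ℚ-ring

A∙C : ∀ p → Aℚ p ∙ Cℚ p ≡ δ p • I
A∙C p = matℚ-cong (entry-a (q p)) (entry-b (q p)) (entry-c (q p)) (entry-d (q p))
  where
  entry-a : ∀ x → 1ℚ * x + (x - 1ℚ) * (x - 1ℚ) ≡ (x * x - x + 1ℚ) * 1ℚ
  entry-a = solve-∀ ℚ-ring
  entry-b : ∀ x → 1ℚ * (1ℚ - x) + (x - 1ℚ) * 1ℚ ≡ (x * x - x + 1ℚ) * 0ℚ
  entry-b = solve-∀ ℚ-ring
  entry-c : ∀ x → (1ℚ - x) * x + x * (x - 1ℚ) ≡ (x * x - x + 1ℚ) * 0ℚ
  entry-c = solve-∀ ℚ-ring
  entry-d : ∀ x → (1ℚ - x) * (1ℚ - x) + x * 1ℚ ≡ (x * x - x + 1ℚ) * 1ℚ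
  entry-d = solve-∀ ℚ-ring

C∙letter : ∀ p l → Cℚ p ∙ letterℚ l p ≡ q p • (letterℚ l (invert p) ∙ Cℚ p)
C∙letter p Rˡ = matℚ-cong
  (sym (by-q*q⁻¹≡1 p (λ z → z * x + x * x - x) (entry-a x y) (entry-a′ x)))
  (sym (by-q*q⁻¹≡1 p (λ z → z - z * x + x) (entry-b x y) (entry-b′ x)))
  (entry-c x) (entry-d x)
  where
  x = q p
  y = q⁻¹ p
  entry-a : ∀ x y → x * (y * x + 1ℚ * (x - 1ℚ)) ≡ (x * y) * x + x * x - x
  entry-a = solve-∀ ℚ-ring
  entry-a′ : ∀ x → 1ℚ * x + x * x - x ≡ x * x + (1ℚ - x) * 0ℚ
  entry-a′ = solve-∀ ℚ-ring
  entry-b : ∀ x y → x * (y * (1ℚ - x) + 1ℚ * 1ℚ) ≡ (x * y) - (x * y) * x + x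
  entry-b = solve-∀ ℚ-ring
  entry-b′ : ∀ x → 1ℚ - 1ℚ * x + x ≡ x * 1ℚ + (1ℚ - x) * 1ℚ
  entry-b′ = solve-∀ ℚ-ring
  entry-c : ∀ x → (x - 1ℚ) * x + 1ℚ * 0ℚ ≡ x * (0ℚ * x + 1ℚ * (x - 1ℚ))
  entry-c = solve-∀ ℚ-ring
  entry-d : ∀ x → (x - 1ℚ) * 1ℚ + 1ℚ * 1ℚ ≡ x * (0ℚ * (1ℚ - x) + 1ℚ * 1ℚ)
  entry-d = solve-∀ ℚ-ring
C∙letter p Lˡ = matℚ-cong
  (sym (by-q*q⁻¹≡1 p (λ z → z * x) (entry-a x y) (entry-a′ x)))
  (sym (by-q*q⁻¹≡1 p (λ z → z * (1ℚ - x)) (entry-b x y) (entry-b′ x)))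
  (sym (by-q*q⁻¹≡1 p (λ z → z * x + x * x - x) (entry-c x y) (entry-c′ x)))
  (sym (by-q*q⁻¹≡1 p (λ z → z - z * x + x) (entry-d x y) (entry-d′ x)))
  where
  x = q p
  y = q⁻¹ p
  entry-a : ∀ x y → x * (y * x + 0ℚ * (x - 1ℚ)) ≡ (x * y) * x
  entry-a = solve-∀ ℚ-ring
  entry-a′ : ∀ x → 1ℚ * x ≡ x * x + (1ℚ - x) * x
  entry-a′ = solve-∀ ℚ-ring
  entry-b : ∀ x y → x * (y * (1ℚ - x) + 0ℚ * 1ℚ) ≡ (x * y) * (1ℚ - x)
  entry-b = solve-∀ ℚ-ring
  entry-b′ : ∀ x → 1ℚ * (1ℚ - x) ≡ x * 0ℚ + (1ℚ - x) * 1ℚ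
  entry-b′ = solve-∀ ℚ-ring
  entry-c : ∀ x y → x * (y * x + 1ℚ * (x - 1ℚ)) ≡ (x * y) * x + x * x - x
  entry-c = solve-∀ ℚ-ring
  entry-c′ : ∀ x → 1ℚ * x + x * x - x ≡ (x - 1ℚ) * x + 1ℚ * x
  entry-c′ = solve-∀ ℚ-ring
  entry-d : ∀ x y → x * (y * (1ℚ - x) + 1ℚ * 1ℚ) ≡ (x * y) - (x * y) * x + x
  entry-d = solve-∀ ℚ-ring
  entry-d′ : ∀ x → 1ℚ - 1ℚ * x + x ≡ (x - 1ℚ) * 0ℚ + 1ℚ * 1ℚ
  entry-d′ = solve-∀ ℚ-ring

C∙positiveWord : ∀ p ls → Cℚ p ∙ positiveWord ls p ≡ (q p ^ length ls) • (positiveWord ls (invert p) ∙ Cℚ p)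
C∙positiveWord p []       = trans (∙-identityʳ (Cℚ p)) (sym (trans (•-identity (I ∙ Cℚ p)) (∙-identityˡ (Cℚ p))))
C∙positiveWord p (l ∷ ls) = begin
  Cℚ p ∙ (X ∙ P)                   ≡⟨ ∙-assoc (Cℚ p) X P ⟨
  (Cℚ p ∙ X) ∙ P                   ≡⟨ cong (_∙ P) (C∙letter p l) ⟩
  (x • (X′ ∙ Cℚ p)) ∙ P            ≡⟨ •-∙-assoc x (X′ ∙ Cℚ p) P ⟩
  x • ((X′ ∙ Cℚ p) ∙ P)            ≡⟨ cong (x •_) (∙-assoc X′ (Cℚ p) P) ⟩
  x • (X′ ∙ (Cℚ p ∙ P))            ≡⟨ cong (λ Y → x • (X′ ∙ Y)) (C∙positiveWord p ls) ⟩
  x • (X′ ∙ (xᵏ • (P′ ∙ Cℚ p)))    ≡⟨ cong (x •_) (∙-•-comm xᵏ X′ (P′ ∙ Cℚ p)) ⟩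
  x • xᵏ • (X′ ∙ (P′ ∙ Cℚ p))      ≡⟨ •-assoc x xᵏ (X′ ∙ (P′ ∙ Cℚ p)) ⟩
  (x * xᵏ) • (X′ ∙ (P′ ∙ Cℚ p))    ≡⟨ cong ((x * xᵏ) •_) (∙-assoc X′ P′ (Cℚ p)) ⟨
  (x * xᵏ) • (X′ ∙ P′ ∙ Cℚ p)      ∎
  where
  open ≡-Reasoning
  x  = q p
  xᵏ = q p ^ length ls
  X  = letterℚ l p
  X′ = letterℚ l (invert p)
  P  = positiveWord ls p
  P′ = positiveWord ls (invert p)

δ*tr-positiveWord : ∀ p ls → δ p * tr (positiveWord ls p) ≡ δ p * (q p ^ length ls * tr (positiveWord ls (invert p)))
δ*tr-positiveWord p ls = begin
  δ p * tr P                          ≡⟨ tr-• (δ p) P ⟨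
  tr (δ p • P)                        ≡⟨ cong tr (•P≡P∙• P) ⟩
  tr (P ∙ (δ p • I))                  ≡⟨ cong (λ Y → tr (P ∙ Y)) (A∙C p) ⟨
  tr (P ∙ (Aℚ p ∙ Cℚ p))              ≡⟨ cong tr (∙-assoc P (Aℚ p) (Cℚ p)) ⟨
  tr ((P ∙ Aℚ p) ∙ Cℚ p)              ≡⟨ tr-∙-comm (P ∙ Aℚ p) (Cℚ p) ⟩
  tr (Cℚ p ∙ (P ∙ Aℚ p))              ≡⟨ cong tr (∙-assoc (Cℚ p) P (Aℚ p)) ⟨
  tr ((Cℚ p ∙ P) ∙ Aℚ p)              ≡⟨ cong (λ Y → tr (Y ∙ Aℚ p)) (C∙positiveWord p ls) ⟩
  tr ((xᵏ • (P′ ∙ Cℚ p)) ∙ Aℚ p)      ≡⟨ cong tr (•-∙-assoc xᵏ (P′ ∙ Cℚ p) (Aℚ p)) ⟩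
  tr (xᵏ • ((P′ ∙ Cℚ p) ∙ Aℚ p))      ≡⟨ tr-• xᵏ ((P′ ∙ Cℚ p) ∙ Aℚ p) ⟩
  xᵏ * tr ((P′ ∙ Cℚ p) ∙ Aℚ p)        ≡⟨ cong (λ Y → xᵏ * tr Y) (∙-assoc P′ (Cℚ p) (Aℚ p)) ⟩
  xᵏ * tr (P′ ∙ (Cℚ p ∙ Aℚ p))        ≡⟨ cong (λ Y → xᵏ * tr (P′ ∙ Y)) (C∙A p) ⟩
  xᵏ * tr (P′ ∙ (δ p • I))            ≡⟨ cong (λ Y → xᵏ * tr Y) (•P≡P∙• P′) ⟨
  xᵏ * tr (δ p • P′)                  ≡⟨ cong (xᵏ *_) (tr-• (δ p) P′) ⟩
  xᵏ * (δ p * tr P′)                  ≡⟨ swap xᵏ (δ p) (tr P′) ⟩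
  δ p * (xᵏ * tr P′)                  ∎
  where
  open ≡-Reasoning
  xᵏ = q p ^ length ls
  P  = positiveWord ls p
  P′ = positiveWord ls (invert p)
  •P≡P∙• : ∀ M → δ p • M ≡ M ∙ (δ p • I)
  •P≡P∙• M = sym (trans (∙-•-comm (δ p) M I) (cong (δ p •_) (∙-identityʳ M)))
  swap : ∀ a b c → a * (b * c) ≡ b * (a * c)
  swap = solve-∀ ℚ-ring

δ-natPoint : ∀ n → δ (natPoint n) ≡ fromℤ (+ suc (n ℕ.* n ℕ.+ n))
δ-natPoint n = begin
  x * x - x + 1ℚ                                   ≡⟨ cong (λ y → y - x + 1ℚ) (fromℤ-* X X) ⟨
  fromℤ (X ℤ.* X) - x + 1ℚ                          ≡⟨ cong (λ y → fromℤ (X ℤ.* X) + y + 1ℚ) (fromℤ-neg X) ⟨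
  fromℤ (X ℤ.* X) + fromℤ (ℤ.- X) + 1ℚ              ≡⟨ cong (_+ 1ℚ) (fromℤ-+ (X ℤ.* X) (ℤ.- X)) ⟨
  fromℤ (X ℤ.* X ℤ.- X) + fromℤ (+ 1)               ≡⟨ fromℤ-+ (X ℤ.* X ℤ.- X) (+ 1) ⟨
  fromℤ (X ℤ.* X ℤ.- X ℤ.+ + 1)                     ≡⟨ cong fromℤ (trans (expand (+ n)) (cong (λ y → y ℤ.+ + n ℤ.+ + 1) (sym (ℤP.pos-* n n)))) ⟩
  fromℤ (+ (n ℕ.* n) ℤ.+ + n ℤ.+ + 1)               ≡⟨ cong (λ m → fromℤ (+ m)) (ℕP.+-comm (n ℕ.* n ℕ.+ n) 1) ⟩
  fromℤ (+ suc (n ℕ.* n ℕ.+ n))                     ∎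
  where
  open ≡-Reasoning
  X = + suc n
  x = fromℤ X
  expand : ∀ m → (+ 1 ℤ.+ m) ℤ.* (+ 1 ℤ.+ m) ℤ.- (+ 1 ℤ.+ m) ℤ.+ + 1 ≡ m ℤ.* m ℤ.+ m ℤ.+ + 1
  expand = ℤ-solve

tr-positiveWord-symmetric : ∀ n ls → let p = natPoint n in
  tr (positiveWord ls p) ≡ q p ^ length ls * tr (positiveWord ls (invert p))
tr-positiveWord-symmetric n ls =
  *-cancelˡ-invertible (δ (natPoint n)) (1/ d) δ⁻¹δ≡1 (δ*tr-positiveWord (natPoint n) ls)
  where
  d = fromℤ (+ suc (n ℕ.* n ℕ.+ n))
  δ⁻¹δ≡1 : 1/ d * δ (natPoint n) ≡ 1ℚ
  δ⁻¹δ≡1 = trans (cong (1/ d *_) (δ-natPoint n)) (ℚP.*-inverseˡ d)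

module _ {A : Set} (z : A) where

  lcoeff-beyond : ∀ cs i → length cs ℕ.≤ i → lcoeff z cs i ≡ z
  lcoeff-beyond []       i       _           = refl
  lcoeff-beyond (c ∷ cs) (suc i) (ℕ.s≤s len) = lcoeff-beyond cs i len

  lcoeff-++ˡ : ∀ xs ys i → i ℕ.< length xs → lcoeff z (xs ++ ys) i ≡ lcoeff z xs i
  lcoeff-++ˡ (x ∷ xs) ys zero    _          = refl
  lcoeff-++ˡ (x ∷ xs) ys (suc i) (ℕ.s≤s i<) = lcoeff-++ˡ xs ys i i<

  lcoeff-++ʳ : ∀ xs ys j → lcoeff z (xs ++ ys) (length xs ℕ.+ j) ≡ lcoeff z ys j
  lcoeff-++ʳ []       ys j = refl
  lcoeff-++ʳ (x ∷ xs) ys j = lcoeff-++ʳ xs ys j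

  lcoeff-reverse : ∀ cs i → i ℕ.< length cs → lcoeff z (reverse cs) i ≡ lcoeff z cs (length cs ℕ.∸ suc i)
  lcoeff-reverse (c ∷ cs) i i<1+ℓ with ℕP.m<1+n⇒m<n∨m≡n i<1+ℓ
  ... | inj₁ i<ℓ = begin
    lcoeff z (reverse (c ∷ cs)) i                ≡⟨ cong (λ xs → lcoeff z xs i) (LP.unfold-reverse c cs) ⟩
    lcoeff z (reverse cs ++ c ∷ []) i            ≡⟨ lcoeff-++ˡ (reverse cs) (c ∷ []) i (subst (i ℕ.<_) (sym (LP.length-reverse cs)) i<ℓ) ⟩
    lcoeff z (reverse cs) i                      ≡⟨ lcoeff-reverse cs i i<ℓ ⟩
    lcoeff z (c ∷ cs) (suc (length cs ℕ.∸ suc i)) ≡⟨ cong (lcoeff z (c ∷ cs)) (ℕP.+-∸-assoc 1 i<ℓ) ⟨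
    lcoeff z (c ∷ cs) (length (c ∷ cs) ℕ.∸ suc i) ∎
    where open ≡-Reasoning
  ... | inj₂ refl = begin
    lcoeff z (reverse (c ∷ cs)) (length cs)                  ≡⟨ cong (λ xs → lcoeff z xs (length cs)) (LP.unfold-reverse c cs) ⟩
    lcoeff z (reverse cs ++ c ∷ []) (length cs)              ≡⟨ cong (lcoeff z (reverse cs ++ c ∷ [])) ℓ≡ℓʳ+0 ⟩
    lcoeff z (reverse cs ++ c ∷ []) (length (reverse cs) ℕ.+ 0) ≡⟨ lcoeff-++ʳ (reverse cs) (c ∷ []) 0 ⟩
    lcoeff z (c ∷ cs) 0                                      ≡⟨ cong (lcoeff z (c ∷ cs)) (ℕP.n∸n≡0 (length cs)) ⟨
    lcoeff z (c ∷ cs) (length cs ℕ.∸ length cs)             ∎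
    where
    open ≡-Reasoning
    ℓ≡ℓʳ+0 : length cs ≡ length (reverse cs) ℕ.+ 0
    ℓ≡ℓʳ+0 = sym (trans (ℕP.+-identityʳ _) (LP.length-reverse cs))

  icoeff-reverse : ∀ cs k → icoeff z (reverse cs) k ≡ icoeff z cs (+ length cs ℤ.- + 1 ℤ.- k)
  icoeff-reverse cs -[1+ i ] = sym (trans (cong (icoeff z cs) (reflect (+ length cs) (+ i)))
                                          (lcoeff-beyond cs (length cs ℕ.+ i) (ℕP.m≤m+n (length cs) i)))
    where
    reflect : ∀ L i → L ℤ.- + 1 ℤ.- ℤ.- (+ 1 ℤ.+ i) ≡ L ℤ.+ i
    reflect = ℤ-solve
  icoeff-reverse cs (+ i) with i ℕ.<? length cs
  ... | yes i<ℓ = trans (lcoeff-reverse cs i i<ℓ) (cong (icoeff z cs) (sym (begin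
    + length cs ℤ.- + 1 ℤ.- + i      ≡⟨ reflect (+ length cs) (+ i) ⟩
    + length cs ℤ.- + suc i          ≡⟨ ℤP.[+m]-[+n]≡m⊖n (length cs) (suc i) ⟩
    length cs ⊖ suc i                ≡⟨ ℤP.⊖-≥ i<ℓ ⟩
    + (length cs ℕ.∸ suc i)          ∎)))
    where
    open ≡-Reasoning
    reflect : ∀ L i → L ℤ.- + 1 ℤ.- i ≡ L ℤ.- (+ 1 ℤ.+ i)
    reflect = ℤ-solve
  ... | no i≮ℓ = trans (lcoeff-beyond (reverse cs) i (subst (ℕ._≤ i) (sym (LP.length-reverse cs)) ℓ≤i))
                       (sym (cong (icoeff z cs) (begin
    + length cs ℤ.- + 1 ℤ.- + i      ≡⟨ reflect (+ length cs) (+ i) ⟩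
    + length cs ℤ.- + suc i          ≡⟨ ℤP.[+m]-[+n]≡m⊖n (length cs) (suc i) ⟩
    length cs ⊖ suc i                ≡⟨ ℤP.⊖-< (ℕ.s≤s ℓ≤i) ⟩
    ℤ.- + (suc i ℕ.∸ length cs)      ≡⟨ cong (λ m → ℤ.- + m) (ℕP.+-∸-assoc 1 ℓ≤i) ⟩
    -[1+ i ℕ.∸ length cs ]           ∎)))
    where
    open ≡-Reasoning
    ℓ≤i = ℕP.≮⇒≥ i≮ℓ
    reflect : ∀ L i → L ℤ.- + 1 ℤ.- i ≡ L ℤ.- (+ 1 ℤ.+ i)
    reflect = ℤ-solve

evalPoly-reverse : ∀ p cs → q p * evalPoly (q p) (reverse cs) ≡ q p ^ length cs * evalPoly (q⁻¹ p) cs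
evalPoly-reverse p []       = trans (ℚP.*-zeroʳ (q p)) (sym (ℚP.*-zeroʳ 1ℚ))
evalPoly-reverse p (c ∷ cs) = begin
  x * evalPoly x (reverse (c ∷ cs))                     ≡⟨ cong (λ ds → x * evalPoly x ds) (LP.unfold-reverse c cs) ⟩
  x * evalPoly x (reverse cs ++ c ∷ [])                 ≡⟨ cong (x *_) (evalPoly-++ x (reverse cs) (c ∷ [])) ⟩
  x * (E + x ^ length (reverse cs) * evalPoly x (c ∷ [])) ≡⟨ cong (λ m → x * (E + x ^ m * evalPoly x (c ∷ []))) (LP.length-reverse cs) ⟩
  x * (E + xᵏ * (fromℤ c + x * 0ℚ))                     ≡⟨ expand x E xᵏ (fromℤ c) ⟩
  x * E + x * xᵏ * fromℤ c                              ≡⟨ cong (_+ x * xᵏ * fromℤ c) (evalPoly-reverse p cs) ⟩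
  xᵏ * E′ + x * xᵏ * fromℤ c                            ≡⟨ by-q*q⁻¹≡1 p (λ u → x * xᵏ * fromℤ c + u * (xᵏ * E′)) (regroup x (q⁻¹ p) xᵏ (fromℤ c) E′) (drop-1 x xᵏ (fromℤ c) E′) ⟨
  (x * xᵏ) * (fromℤ c + q⁻¹ p * E′)                     ∎
  where
  open ≡-Reasoning
  x  = q p
  E  = evalPoly x (reverse cs)
  E′ = evalPoly (q⁻¹ p) cs
  xᵏ = x ^ length cs
  expand : ∀ x E y c → x * (E + y * (c + x * 0ℚ)) ≡ x * E + x * y * c
  expand = solve-∀ ℚ-ring
  drop-1 : ∀ x y c E′ → x * y * c + 1ℚ * (y * E′) ≡ y * E′ + x * y * c
  drop-1 = solve-∀ ℚ-ring
  regroup : ∀ x x⁻¹ y c E′ → (x * y) * (c + x⁻¹ * E′) ≡ x * y * c + (x * x⁻¹) * (y * E′)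
  regroup = solve-∀ ℚ-ring

-- q^k · cs(q⁻¹) as a Laurent polynomial.
mirror : ℕ → List ℤ → Laurent
mirror k cs = mkL (+ k ℤ.- + length cs ℤ.+ + 1) (reverse cs)

evalL-mirror : ∀ p k cs → evalL p (mirror k cs) ≡ q p ^ k * evalPoly (q⁻¹ p) cs
evalL-mirror p k cs = begin
  p ^ᶻ (d ℤ.+ + 1) * evalPoly x (reverse cs)            ≡⟨ cong (_* evalPoly x (reverse cs)) (^ᶻ-+ p d (+ 1)) ⟩
  (p ^ᶻ d * (x * 1ℚ)) * evalPoly x (reverse cs)         ≡⟨ reassoc (p ^ᶻ d) x (evalPoly x (reverse cs)) ⟩
  p ^ᶻ d * (x * evalPoly x (reverse cs))                ≡⟨ cong (p ^ᶻ d *_) (evalPoly-reverse p cs) ⟩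
  p ^ᶻ d * (p ^ᶻ + length cs * evalPoly (q⁻¹ p) cs)     ≡⟨ ℚP.*-assoc (p ^ᶻ d) _ _ ⟨
  (p ^ᶻ d * p ^ᶻ + length cs) * evalPoly (q⁻¹ p) cs     ≡⟨ cong (_* evalPoly (q⁻¹ p) cs) (^ᶻ-+ p d (+ length cs)) ⟨
  p ^ᶻ (d ℤ.+ + length cs) * evalPoly (q⁻¹ p) cs        ≡⟨ cong (λ i → p ^ᶻ i * evalPoly (q⁻¹ p) cs) (cancel (+ k) (+ length cs)) ⟩
  p ^ᶻ + k * evalPoly (q⁻¹ p) cs                        ∎
  where
  open ≡-Reasoning
  x = q p
  d = + k ℤ.- + length cs
  reassoc : ∀ a x e → (a * (x * 1ℚ)) * e ≡ a * (x * e)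
  reassoc = solve-∀ ℚ-ring
  cancel : ∀ K L → K ℤ.- L ℤ.+ L ≡ K
  cancel = ℤ-solve

coeff-mirror : ∀ k cs j → coeff (mirror k cs) j ≡ icoeff (+ 0) cs (+ k ℤ.- j)
coeff-mirror k cs j = trans (icoeff-reverse (+ 0) cs (j ℤ.- (+ k ℤ.- + length cs ℤ.+ + 1)))
                            (cong (icoeff (+ 0) cs) (reflect (+ length cs) j (+ k)))
  where
  reflect : ∀ L j K → L ℤ.- + 1 ℤ.- (j ℤ.- (K ℤ.- L ℤ.+ + 1)) ≡ K ℤ.- j
  reflect = ℤ-solve

icoeff-map-+ : ∀ T k → icoeff (+ 0) (map +_ T) k ≡ + icoeff 0 T k
icoeff-map-+ T -[1+ i ] = refl
icoeff-map-+ T (+ i)    = lcoeff-map-+ T i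
  where
  lcoeff-map-+ : ∀ T i → lcoeff (+ 0) (map +_ T) i ≡ + lcoeff 0 T i
  lcoeff-map-+ []      i       = refl
  lcoeff-map-+ (t ∷ T) zero    = refl
  lcoeff-map-+ (t ∷ T) (suc i) = lcoeff-map-+ T i

symmetric⇒palindromic : ∀ T k →
  (∀ n → let p = natPoint n in evalPolyℕ (q p) T ≡ q p ^ k * evalPolyℕ (q⁻¹ p) T) → Palindromic T
symmetric⇒palindromic T k symmetric = + k , λ j → ℤP.+-injective (begin
  + icoeff 0 T j                 ≡⟨ icoeff-map-+ T j ⟨
  icoeff (+ 0) T′ j              ≡⟨ cong (icoeff (+ 0) T′) (ℤP.+-identityʳ j) ⟨
  coeff (embed T) j              ≡⟨ evalL-injective (embed T) (mirror k T′) embed≡mirror j ⟩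
  coeff (mirror k T′) j          ≡⟨ coeff-mirror k T′ j ⟩
  icoeff (+ 0) T′ (+ k ℤ.- j)    ≡⟨ icoeff-map-+ T (+ k ℤ.- j) ⟩
  + icoeff 0 T (+ k ℤ.- j)       ∎)
  where
  open ≡-Reasoning
  T′ = map +_ T
  embed≡mirror : ∀ n → evalL (natPoint n) (embed T) ≡ evalL (natPoint n) (mirror k T′)
  embed≡mirror n = trans (ℚP.*-identityˡ _) (trans (symmetric n) (sym (evalL-mirror (natPoint n) k T′)))

shapePoly : Shape → List ℕ
shapePoly trace-zero    = []
shapePoly trace-one     = 1 ∷ []
shapePoly (positive ls) = trℕ (positiveWordℕ ls)

shapeDegree : Shape → ℕ
shapeDegree trace-zero    = 0
shapeDegree trace-one     = 0
shapeDegree (positive ls) = length ls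

evalPolyℕ-shapePoly : ∀ p sh → evalPolyℕ (q p) (shapePoly sh) ≡ shapeTrace sh p
evalPolyℕ-shapePoly p trace-zero    = refl
evalPolyℕ-shapePoly p trace-one     = evalPolyℕ-1 (q p)
evalPolyℕ-shapePoly p (positive ls) = evalPolyℕ-trℕ p ls

shapeTrace-symmetric : ∀ n sh → let p = natPoint n in
  shapeTrace sh p ≡ q p ^ shapeDegree sh * shapeTrace sh (invert p)
shapeTrace-symmetric n trace-zero    = refl
shapeTrace-symmetric n trace-one     = refl
shapeTrace-symmetric n (positive ls) = tr-positiveWord-symmetric n ls

shapePoly-palindromic : ∀ sh → Palindromic (shapePoly sh)
shapePoly-palindromic sh = symmetric⇒palindromic (shapePoly sh) (shapeDegree sh) symmetric
  where
  symmetric : ∀ n → let p = natPoint n in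
    evalPolyℕ (q p) (shapePoly sh) ≡ q p ^ shapeDegree sh * evalPolyℕ (q⁻¹ p) (shapePoly sh)
  symmetric n = begin
    evalPolyℕ (q p) (shapePoly sh)         ≡⟨ evalPolyℕ-shapePoly p sh ⟩
    shapeTrace sh p                        ≡⟨ shapeTrace-symmetric n sh ⟩
    xᵏ * shapeTrace sh (invert p)          ≡⟨ cong (xᵏ *_) (evalPolyℕ-shapePoly (invert p) sh) ⟨
    xᵏ * evalPolyℕ (q⁻¹ p) (shapePoly sh)  ∎
    where
    open ≡-Reasoning
    p = natPoint n
    xᵏ = q p ^ shapeDegree sh

trace-evalWord : ∀ w → HasShape (λ p → tr (evalM p (evalWord w)))
trace-evalWord w = HasShape-∼ (wordUnit w , λ p → trans (cong tr (evalM-evalWord p w)) (tr-• (⟦ wordUnit w ⟧ᵘ p) (⟦ wordSU w ⟧ʷ p)))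
                              (trace-SUWord (wordSU w))

trace-evalWord≈ : ∀ w → Σ Sign λ s → Σ ℤ λ N → Σ Shape λ sh → trace (evalWord w) ≈ unit s N *L embed (shapePoly sh)
trace-evalWord≈ w = lift (trace-evalWord w)
  where
  lift : HasShape (λ p → tr (evalM p (evalWord w))) →
         Σ Sign λ s → Σ ℤ λ N → Σ Shape λ sh → trace (evalWord w) ≈ unit s N *L embed (shapePoly sh)
  lift (sh , (s , N) , tr≡) = s , N , sh , evalL-injective (trace (evalWord w)) (unit s N *L embed (shapePoly sh)) same
    where
    same : ∀ n → evalL (natPoint n) (trace (evalWord w)) ≡ evalL (natPoint n) (unit s N *L embed (shapePoly sh))
    same n = begin
      evalL p (trace (evalWord w))                         ≡⟨ evalL-trace p (evalWord w) ⟩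
      tr (evalM p (evalWord w))                            ≡⟨ tr≡ p ⟩
      ⟦ s , N ⟧ᵘ p * shapeTrace sh p                       ≡⟨ cong₂ _*_ (evalL-unit p s N) (evalPolyℕ-shapePoly p sh) ⟨
      evalL p (unit s N) * evalPolyℕ (q p) (shapePoly sh)  ≡⟨ cong (evalL p (unit s N) *_) (ℚP.*-identityˡ (evalPolyℕ (q p) (shapePoly sh))) ⟨
      evalL p (unit s N) * evalL p (embed (shapePoly sh))  ≡⟨ evalL-*L p (unit s N) (embed (shapePoly sh)) ⟨
      evalL p (unit s N *L embed (shapePoly sh))           ∎
      where
      open ≡-Reasoning
      p = natPoint n

theorem1p4 : (w : List Gen) (M : Mat) → Represents M (evalWord w) →
    Σ Sign λ s → Σ ℤ λ N → Σ (List ℕ) λ T →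
      Palindromic T × (trace M ≈ unit s N *L embed T)
theorem1p4 w M (_ , s₀ , N₀ , M≈u₀W) =
  let s , N , sh , trW≈ = trace-evalWord≈ w in
  s₀ Sign.* s , N₀ ℤ.+ N , shapePoly sh , shapePoly-palindromic sh ,
  ≈-trans (trace-scale (s₀ ℤ.◃ 1) N₀ (evalWord w) M≈u₀W)
          (≈-trans (mono-*L-cong (s₀ ℤ.◃ 1) N₀ trW≈) (unit-*L-unit s₀ N₀ s N (embed (shapePoly sh))))
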